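{- Let $m$ be a positive integer, let $r,t$ be integers with $0\leq r\leq t\leq m$, and let $s_1,\dots,s_t$ be positive integers such that $s_1,\dots,s_r$ are even, $s_{r+1},\dots,s_t$ are odd, and $s_t\mid\cdots\mid s_1$. Let $D_m(\bm{s})$ be the $m\times(m^2-m+t)$ integer matrix whose columns are $s_1\bm{e}_1,\dots,s_t\bm{e}_t$ together with $\bm{e}_i-\bm{e}_j$ and $\bm{e}_i+\bm{e}_j$ for $1\leq i<j\leq m$, where $\bm{e}_i\in\mathbb{Z}^m$ is the $i$th standard unit column vector. Let $\rho:=\operatorname{lcm}(s_1,2)$ if $t\geq 1$ and $\rho:=2$ if $t=0$. Let $k$ be a positive integer with $k\mid\rho$ and put $d_i:=\gcd(k,s_i)$ for $1\leq i\leq t$. For $q\in k+\rho\mathbb{Z}_{\geq 0}$ let $\chi^k_{D_m(\bm{s})}(q)$ denote the number of $\bm{x}=(x_1,\dots,x_m)\in\mathbb{Z}_q^m$ such that every entry of $\bm{x}[D_m(\bm{s})]_q$ is nonzero, i.e. $s_ix_i\neq0$ for $1\leq i\leq t$ and $x_i-x_j\neq 0$, $x_i+x_j\neq 0$ for $1\leq i<j\leq m$. Then: If $k$ is odd, for all $q\in k+\rho\mathbb{Z}_{\geq 0}$, $$\chi^k_{D_m(\bm{s})}(q)=\prod_{i=1}^{t}(q-d_i-2i+2)\left(\prod_{i=t+1}^{m}(q-2i+1)+(m-t)\prod_{i=t+1}^{m-1}(q-2i+1)\right).$$ If $k$ is even, for all $q\in k+\rho\mathbb{Z}_{\geq 0}$,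 $$\chi^k_{D_m(\bm{s})}(q)=\prod_{i=1}^{r}(q-d_i-2i+2)\,(P_1+P_2),$$ where $$P_1:=\prod_{i=r+1}^{t}(q-d_i-2i+1)\left(\prod_{i=t+1}^{m}(q-2i)+2(m-t)\prod_{i=t+1}^{m-1}(q-2i)+(m-t)(m-t-1)\prod_{i=t+1}^{m-2}(q-2i)\right),$$ $$P_2:=\left(\sum_{i=r+1}^{t}\prod_{j=r+1}^{i-1}(q-d_j-2j+1)\prod_{j=i+1}^{t}(q-d_j-2j+3)\right)\left(\prod_{i=t+1}^{m}(q-2i+2)+(m-t)\prod_{i=t+1}^{m-1}(q-2i+2)\right).$$ In particular, if $t=m$: for $k$ odd, $\chi^k_{D_m(\bm{s})}(q)=\prod_{i=1}^{m}(q-d_i-2i+2)$; for $k$ even, $$\chi^k_{D_m(\bm{s})}(q)=\prod_{i=1}^{r}(q-d_i-2i+2)\left(\prod_{i=r+1}^{m}(q-d_i-2i+1)+\sum_{i=r+1}^{m}\prod_{j=r+1}^{i-1}(q-d_j-2j+1)\prod_{j=i+1}^{m}(q-d_j-2j+3)\right).$$ Equivalently, these polynomials are the $k$-constituents of the characteristic quasi-polynomial of $D_m(\bm{s})$ with respect to the period $\rho$.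
   Context: $\mathbb{Z}_q=\mathbb{Z}/q\mathbb{Z}$ and $[S]_q$ denotes entrywise reduction mod $q$. For an integer matrix $S$ with $m$ rows and $n$ columns, the characteristic quasi-polynomial is $q\mapsto\#\{\bm{x}\in\mathbb{Z}_q^m\mid\bm{x}[S]_q\in(\mathbb{Z}_q\setminus\{0\})^n\}$, a quasi-polynomial with period $\rho$; its $k$-constituent is the polynomial agreeing with it for $q\equiv k\pmod\rho$. Empty sums equal $0$ and empty products equal $1$. -}

module Defs where

open import Data.Nat as ℕ using (ℕ; zero; suc; _≤_; _<_; _∸_; _<ᵇ_)
open import Data.Nat.Divisibility using (_∣_; _∣?_)
open import Data.Nat.GCD using (gcd)
open import Data.Nat.LCM using (lcm)
open import Data.Integer as ℤ using (ℤ; +_; ∣_∣)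
open import Data.Fin using (Fin; toℕ; _≟_)
open import Data.List using (List; []; _∷_; map; concatMap; filter; length; foldr; applyUpTo; allFin)
open import Data.List.Relation.Unary.All using (All; all?)
open import Data.Bool using (if_then_else_)
open import Relation.Nullary using (¬_; ¬?)
open import Relation.Nullary.Decidable using (⌊_⌋)

-- Integer matrices with m rows, given as a list of columns.
-- A column is a function Fin m → ℤ (its entries).

Column : ℕ → Set
Column m = Fin m → ℤ

allVecs : (m q : ℕ) → List (Fin m → Fin q)
allVecs zero    q = (λ ()) ∷ []
allVecs (suc m) q =
  concatMap (λ a → map (λ f → λ { Fin.zero → a ; (Fin.suc i) → f i }) (allVecs m q))
            (allFin q)

-- the entry of x [c]_q (as an integer representative, before reducing mod q)
entry : ∀ {m q} → (Fin m → Fin q) → Column m → ℤ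
entry {m} x c = foldr (λ i acc → (+ toℕ (x i)) ℤ.* c i ℤ.+ acc) (+ 0) (allFin m)

-- x [S]_q has all entries nonzero in ℤ_q (an entry is zero in ℤ_q iff q divides it)
AllNonzero : ∀ {m} (q : ℕ) → List (Column m) → (Fin m → Fin q) → Set
AllNonzero q S x = All (λ c → ¬ (q ∣ ∣ entry x c ∣)) S

charQP : ∀ {m} → List (Column m) → ℕ → ℕ
charQP {m} S q =
  length (filter (λ x → all? (λ c → ¬? (q ∣? ∣ entry x c ∣)) S) (allVecs m q))

-- The matrix D_m(s).  s is indexed 1-based: s 1, …, s t are used.

unitVec : ∀ {m} → Fin m → Column m
unitVec i j = if ⌊ i ≟ j ⌋ then + 1 else + 0

D : (m t : ℕ) → (ℕ → ℕ) → List (Column m)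
D m t s =
  concatMap (λ i → if toℕ i <ᵇ t
                     then (λ j → (+ s (suc (toℕ i))) ℤ.* unitVec i j) ∷ []
                     else [])
            (allFin m)
  Data.List.++
  concatMap (λ i → concatMap (λ j →
      if toℕ i <ᵇ toℕ j
        then (λ l → unitVec i l ℤ.- unitVec j l) ∷ (λ l → unitVec i l ℤ.+ unitVec j l) ∷ []
        else [])
      (allFin m)) (allFin m)

-- Ranges, sums and products over integer ranges a..b (empty if b < a)

range : ℕ → ℕ → List ℕ
range a b = applyUpTo (a ℕ.+_) (suc b ∸ a)

prodR : ℕ → ℕ → (ℕ → ℤ) → ℤ
prodR a b f = foldr (λ i acc → f i ℤ.* acc) (+ 1) (range a b)

sumR : ℕ → ℕ → (ℕ → ℤ) → ℤ
sumR a b f = foldr (λ i acc → f i ℤ.+ acc) (+ 0) (range a b)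

rho : ℕ → (ℕ → ℕ) → ℕ
rho zero    s = 2
rho (suc _) s = lcm (s 1) 2

{-# OPTIONS --safe #-}

-- Choose x₁, x₂, … one entry at a time. Given the first p entries, the admissible values of the next
-- one are of three kinds: 0, the half q/2 (when q is even), and the remaining generic residues, which
-- pair up as {y, q - y}. An earlier generic entry y rules out exactly the pair {y, q - y}; an earlier
-- 0 or q/2 rules out only itself. The column sₚ₊₁eₚ₊₁ (present when p < t) further rules out the
-- gcd(q, sₚ₊₁) residues a with q ∣ sₚ₊₁a, among them 0, and it rules out q/2 exactly when sₚ₊₁ is
-- even. So the number of choices depends only on p and on whether 0 and q/2 have been used, which
-- gives a linear recurrence in these two flags whose solution is the product formula. Along
-- q ≡ k (mod ρ) one has gcd(q, sᵢ) = gcd(k, sᵢ) since sᵢ ∣ ρ, and q is even exactly when k is.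

module Submission where

open import Defs
open import Data.Nat using (ℕ; zero; suc; _≤_; _<_; _∸_)
open import Data.Nat.Divisibility using (_∣_)
open import Data.Nat.GCD using (gcd)
open import Data.Bool using (Bool)
open import Relation.Nullary using (¬_)
open import Relation.Binary.PropositionalEquality using (_≡_; refl; trans)

module Booleans where

  open import Data.Nat using (_≡ᵇ_; _<ᵇ_)
  import Data.Nat.Properties as ℕₚ
  open import Data.Bool using (true; false; T; not; _∧_; _∨_)
  open import Data.Empty using (⊥-elim)
  open import Relation.Nullary using (Dec; yes; no; does)
  open import Relation.Binary.PropositionalEquality

  T⇒≡true : ∀ {b} → T b → b ≡ true
  T⇒≡true {true} _ = refl

  ≡true⇒T : ∀ {b} → b ≡ true → T b
  ≡true⇒T refl = _

  true≢false : true ≢ false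
  true≢false ()

  does-true⁻¹ : ∀ {P : Set} (P? : Dec P) → does P? ≡ true → P
  does-true⁻¹ (yes p) _ = p

  does-⇔ : ∀ {P Q : Set} (P? : Dec P) (Q? : Dec Q) → (P → Q) → (Q → P) → does P? ≡ does Q?
  does-⇔ (yes _) (yes _) _   _   = refl
  does-⇔ (no _)  (no _)  _   _   = refl
  does-⇔ (yes p) (no ¬q) p⇒q _   = ⊥-elim (¬q (p⇒q p))
  does-⇔ (no ¬p) (yes q) _   q⇒p = ⊥-elim (¬p (q⇒p q))

  ≡ᵇ-true : ∀ {m n} → m ≡ n → (m ≡ᵇ n) ≡ true
  ≡ᵇ-true {m} {n} m≡n = T⇒≡true (ℕₚ.≡⇒≡ᵇ m n m≡n)

  ≡ᵇ-true⁻¹ : ∀ m n → (m ≡ᵇ n) ≡ true → m ≡ n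
  ≡ᵇ-true⁻¹ m n eq = ℕₚ.≡ᵇ⇒≡ m n (≡true⇒T eq)

  ≡ᵇ-false : ∀ {m n} → m ≢ n → (m ≡ᵇ n) ≡ false
  ≡ᵇ-false {m} {n} m≢n with m ≡ᵇ n in eq
  ... | false = refl
  ... | true  = ⊥-elim (m≢n (≡ᵇ-true⁻¹ m n eq))

  ≡ᵇ-false⁻¹ : ∀ m n → (m ≡ᵇ n) ≡ false → m ≢ n
  ≡ᵇ-false⁻¹ m n eq m≡n = true≢false (trans (sym (≡ᵇ-true m≡n)) eq)

  <ᵇ-true : ∀ {m n} → m < n → (m <ᵇ n) ≡ true
  <ᵇ-true m<n = T⇒≡true (ℕₚ.<⇒<ᵇ m<n)

  <ᵇ-true⁻¹ : ∀ m n → (m <ᵇ n) ≡ true → m < n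
  <ᵇ-true⁻¹ m n eq = ℕₚ.<ᵇ⇒< m n (≡true⇒T eq)

  <ᵇ-false : ∀ {m n} → n ≤ m → (m <ᵇ n) ≡ false
  <ᵇ-false {m} {n} n≤m with m <ᵇ n in eq
  ... | false = refl
  ... | true  = ⊥-elim (ℕₚ.<⇒≱ (<ᵇ-true⁻¹ m n eq) n≤m)

  ≢true⇒≡false : ∀ {b} → b ≢ true → b ≡ false
  ≢true⇒≡false {false} _ = refl
  ≢true⇒≡false {true}  b≢true = ⊥-elim (b≢true refl)

  not-true⁻¹ : ∀ {b} → not b ≡ true → b ≡ false
  not-true⁻¹ {false} _ = refl

  ∧-true₁ : ∀ {x y} → x ∧ y ≡ true → x ≡ true
  ∧-true₁ {true} _ = refl

  ∧-true₂ : ∀ {x y} → x ∧ y ≡ true → y ≡ true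
  ∧-true₂ {true} y≡true = y≡true

  not-∨ : ∀ x y → not (x ∨ y) ≡ not x ∧ not y
  not-∨ true  y = refl
  not-∨ false y = refl

module Count where

  open import Data.Nat using (_+_; _≡ᵇ_)
  import Data.Nat.Properties as ℕₚ
  open import Data.Integer as ℤ using (ℤ; +_)
  import Data.Integer.Properties as ℤₚ
  open import Algebra.Properties.CommutativeSemigroup ℕₚ.+-commutativeSemigroup
    using () renaming (interchange to +-interchange)
  open import Algebra.Properties.CommutativeSemigroup ℤₚ.+-commutativeSemigroup
    using () renaming (interchange to +ℤ-interchange)
  open import Data.Bool using (true; false; _∧_; _∨_; not; if_then_else_)
  open import Data.Empty using (⊥-elim)
  open import Data.Sum using (inj₁; inj₂)
  open import Relation.Binary.PropositionalEquality
  open ≡-Reasoning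
  open Booleans using (true≢false; ≡ᵇ-true; ≡ᵇ-true⁻¹; ∧-true₂)

  𝟙 : Bool → ℕ
  𝟙 true  = 1
  𝟙 false = 0

  𝟙-∨-disjoint : ∀ x z → (x ≡ true → z ≡ false) → 𝟙 (x ∨ z) ≡ 𝟙 x + 𝟙 z
  𝟙-∨-disjoint true  z x⇒¬z rewrite x⇒¬z refl = refl
  𝟙-∨-disjoint false z _                      = refl

  𝟙-trichotomy : ∀ x y → (x ≡ true → y ≡ false) → 𝟙 (not x ∧ not y) + 𝟙 x + 𝟙 y ≡ 1
  𝟙-trichotomy true  true  x⇒¬y = ⊥-elim (true≢false (x⇒¬y refl))
  𝟙-trichotomy true  false _ = refl
  𝟙-trichotomy false true  _ = refl
  𝟙-trichotomy false false _ = refl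

  count : ℕ → (ℕ → Bool) → ℕ
  count zero    b = 0
  count (suc n) b = count n b + 𝟙 (b n)

  sum : ℕ → (ℕ → ℤ) → ℤ
  sum zero    f = + 0
  sum (suc n) f = sum n f ℤ.+ f n

  count-cong : ∀ n {b c : ℕ → Bool} → (∀ a → a < n → b a ≡ c a) → count n b ≡ count n c
  count-cong zero    eq = refl
  count-cong (suc n) eq =
    cong₂ _+_ (count-cong n (λ a a<n → eq a (ℕₚ.m<n⇒m<1+n a<n))) (cong 𝟙 (eq n ℕₚ.≤-refl))

  𝟙-split : ∀ x y → 𝟙 x ≡ 𝟙 (x ∧ y) + 𝟙 (x ∧ not y)
  𝟙-split true  true  = refl
  𝟙-split true  false = refl
  𝟙-split false y     = refl

  count-split : ∀ n (b c : ℕ → Bool) →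
    count n b ≡ count n (λ a → b a ∧ c a) + count n (λ a → b a ∧ not (c a))
  count-split zero    b c = refl
  count-split (suc n) b c =
    trans (cong₂ _+_ (count-split n b c) (𝟙-split (b n) (c n)))
          (+-interchange (count n (λ a → b a ∧ c a)) (count n (λ a → b a ∧ not (c a))) _ _)

  count-none : ∀ n b → (∀ a → a < n → b a ≡ false) → count n b ≡ 0
  count-none zero    b none = refl
  count-none (suc n) b none rewrite none n ℕₚ.≤-refl =
    trans (ℕₚ.+-identityʳ _) (count-none n b (λ a a<n → none a (ℕₚ.m<n⇒m<1+n a<n)))

  count-all : ∀ n b → (∀ a → a < n → b a ≡ true) → count n b ≡ n
  count-all zero    b all = refl
  count-all (suc n) b all rewrite all n ℕₚ.≤-refl =
    trans (cong (_+ 1) (count-all n b (λ a a<n → all a (ℕₚ.m<n⇒m<1+n a<n)))) (ℕₚ.+-comm n 1)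

  count-atMostOne : ∀ n b e → e < n → (∀ a → a < n → b a ≡ true → a ≡ e) → count n b ≡ 𝟙 (b e)
  count-atMostOne (suc n) b e e<1+n only with ℕₚ.m≤n⇒m<n∨m≡n e<1+n
  ... | inj₁ e<n = trans (cong₂ _+_ (count-atMostOne n b e (ℕₚ.≤-pred e<n) only′) bn≡0) (ℕₚ.+-identityʳ _)
    where
    only′ : ∀ a → a < n → b a ≡ true → a ≡ e
    only′ a a<n = only a (ℕₚ.m<n⇒m<1+n a<n)
    bn≡0 : 𝟙 (b n) ≡ 0
    bn≡0 with b n in bn
    ... | false = refl
    ... | true  = ⊥-elim (ℕₚ.<-irrefl (sym (only n ℕₚ.≤-refl bn)) (ℕₚ.≤-pred e<n))
  ... | inj₂ refl = cong (_+ 𝟙 (b n)) (count-none n b none)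
    where
    none : ∀ a → a < n → b a ≡ false
    none a a<n with b a in ba
    ... | false = refl
    ... | true  = ⊥-elim (ℕₚ.<-irrefl (only a (ℕₚ.m<n⇒m<1+n a<n) ba) a<n)

  count-remove : ∀ n b e → e < n → b e ≡ true → count n b ≡ suc (count n (λ a → b a ∧ not (a ≡ᵇ e)))
  count-remove n b e e<n be = begin
    count n b
      ≡⟨ count-split n b (λ a → a ≡ᵇ e) ⟩
    count n (λ a → b a ∧ (a ≡ᵇ e)) + count n (λ a → b a ∧ not (a ≡ᵇ e))
      ≡⟨ cong (_+ count n (λ a → b a ∧ not (a ≡ᵇ e))) only-e ⟩
    suc (count n (λ a → b a ∧ not (a ≡ᵇ e))) ∎
    where
    only-e : count n (λ a → b a ∧ (a ≡ᵇ e)) ≡ 1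
    only-e = trans (count-atMostOne n _ e e<n (λ a _ ok → ≡ᵇ-true⁻¹ a e (∧-true₂ ok)))
                   (cong 𝟙 (cong₂ _∧_ be (≡ᵇ-true {e} refl)))

  count-+ : ∀ m n b → count (m + n) b ≡ count m b + count n (λ a → b (m + a))
  count-+ m zero    b = trans (cong (λ k → count k b) (ℕₚ.+-identityʳ m)) (sym (ℕₚ.+-identityʳ _))
  count-+ m (suc n) b rewrite ℕₚ.+-suc m n =
    trans (cong (_+ 𝟙 (b (m + n))) (count-+ m n b)) (ℕₚ.+-assoc (count m b) _ _)

  sum-cong : ∀ n {f g : ℕ → ℤ} → (∀ a → a < n → f a ≡ g a) → sum n f ≡ sum n g
  sum-cong zero    eq = refl
  sum-cong (suc n) eq =
    cong₂ ℤ._+_ (sum-cong n (λ a a<n → eq a (ℕₚ.m<n⇒m<1+n a<n))) (eq n ℕₚ.≤-refl)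

  sum-+ : ∀ n f g → sum n (λ a → f a ℤ.+ g a) ≡ sum n f ℤ.+ sum n g
  sum-+ zero    f g = refl
  sum-+ (suc n) f g =
    trans (cong (ℤ._+ (f n ℤ.+ g n)) (sum-+ n f g)) (+ℤ-interchange (sum n f) (sum n g) (f n) (g n))

  sum-suc : ∀ n f → sum (suc n) f ≡ f 0 ℤ.+ sum n (λ a → f (suc a))
  sum-suc zero    f = trans (ℤₚ.+-identityˡ (f 0)) (sym (ℤₚ.+-identityʳ (f 0)))
  sum-suc (suc n) f = trans (cong (ℤ._+ f (suc n)) (sum-suc n f)) (ℤₚ.+-assoc (f 0) _ _)

  if-indicator : ∀ x (c : ℤ) → (if x then c else + 0) ≡ + 𝟙 x ℤ.* c
  if-indicator true  c = sym (ℤₚ.*-identityˡ c)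
  if-indicator false c = sym (ℤₚ.*-zeroˡ c)

  sum-indicator : ∀ n b (c : ℤ) → sum n (λ a → if b a then c else + 0) ≡ + count n b ℤ.* c
  sum-indicator zero    b c = sym (ℤₚ.*-zeroˡ c)
  sum-indicator (suc n) b c = begin
    sum n (λ a → if b a then c else + 0) ℤ.+ (if b n then c else + 0)
      ≡⟨ cong₂ ℤ._+_ (sum-indicator n b c) (if-indicator (b n) c) ⟩
    + count n b ℤ.* c ℤ.+ + 𝟙 (b n) ℤ.* c    ≡⟨ ℤₚ.*-distribʳ-+ c (+ count n b) (+ 𝟙 (b n)) ⟨
    (+ count n b ℤ.+ + 𝟙 (b n)) ℤ.* c       ≡⟨ cong (ℤ._* c) (ℤₚ.pos-+ (count n b) (𝟙 (b n))) ⟨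
    + count (suc n) b ℤ.* c                 ∎

  if-by-kind : ∀ (o x y z h : Bool) (W : Bool → Bool → ℤ) → (x ≡ true → y ≡ false) →
    (if o then W (x ∨ z) (y ∨ h) else + 0)
      ≡ (if o ∧ (not x ∧ not y) then W z h else + 0) ℤ.+ (if o ∧ x then W true h else + 0)
        ℤ.+ (if o ∧ y then W z true else + 0)
  if-by-kind false x     y     z h W _    = refl
  if-by-kind true  true  true  z h W x⇒¬y = ⊥-elim (true≢false (x⇒¬y refl))
  if-by-kind true  true  false z h W _    = sym (trans (ℤₚ.+-identityʳ _) (ℤₚ.+-identityˡ _))
  if-by-kind true  false true  z h W _    = sym (ℤₚ.+-identityˡ (W z true))
  if-by-kind true  false false z h W _    = sym (trans (ℤₚ.+-identityʳ _) (ℤₚ.+-identityʳ _))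

  sum-by-kind : ∀ n (ok x y : ℕ → Bool) (z h : Bool) (W : Bool → Bool → ℤ) →
    (∀ a → x a ≡ true → y a ≡ false) →
    sum n (λ a → if ok a then W (x a ∨ z) (y a ∨ h) else + 0)
      ≡ + count n (λ a → ok a ∧ (not (x a) ∧ not (y a))) ℤ.* W z h
        ℤ.+ + count n (λ a → ok a ∧ x a) ℤ.* W true h ℤ.+ + count n (λ a → ok a ∧ y a) ℤ.* W z true
  sum-by-kind n ok x y z h W x⇒¬y = begin
    sum n (λ a → if ok a then W (x a ∨ z) (y a ∨ h) else + 0)
      ≡⟨ sum-cong n (λ a _ → if-by-kind (ok a) (x a) (y a) z h W (x⇒¬y a)) ⟩
    sum n (λ a → G a ℤ.+ Z a ℤ.+ H a)
      ≡⟨ trans (sum-+ n (λ a → G a ℤ.+ Z a) H) (cong (ℤ._+ sum n H) (sum-+ n G Z)) ⟩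
    sum n G ℤ.+ sum n Z ℤ.+ sum n H
      ≡⟨ cong₂ ℤ._+_ (cong₂ ℤ._+_ (sum-indicator n _ (W z h)) (sum-indicator n _ (W true h)))
                     (sum-indicator n _ (W z true)) ⟩
    + count n (λ a → ok a ∧ (not (x a) ∧ not (y a))) ℤ.* W z h
      ℤ.+ + count n (λ a → ok a ∧ x a) ℤ.* W true h ℤ.+ + count n (λ a → ok a ∧ y a) ℤ.* W z true ∎
    where
    G Z H : ℕ → ℤ
    G a = if ok a ∧ (not (x a) ∧ not (y a)) then W z h else + 0
    Z a = if ok a ∧ x a then W true h else + 0
    H a = if ok a ∧ y a then W z true else + 0

module Ranges where

  import Data.Nat as ℕ
  import Data.Nat.Properties as ℕₚ
  open import Data.Integer using (ℤ; +_; _+_; _*_)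
  import Data.Integer.Properties as ℤₚ
  open import Data.List using (foldr; applyUpTo)
  open import Relation.Binary.PropositionalEquality

  -- prodR a b f unfolds to prodFrom a (suc b ∸ a) f, so the two are used interchangeably.
  prodFrom : ℕ → ℕ → (ℕ → ℤ) → ℤ
  prodFrom a n f = foldr (λ i acc → f i * acc) (+ 1) (applyUpTo (a ℕ.+_) n)

  foldr-*-applyUpTo : ∀ n (h₁ h₂ : ℕ → ℕ) (f₁ f₂ : ℕ → ℤ) → (∀ j → f₁ (h₁ j) ≡ f₂ (h₂ j)) →
    foldr (λ i acc → f₁ i * acc) (+ 1) (applyUpTo h₁ n) ≡ foldr (λ i acc → f₂ i * acc) (+ 1) (applyUpTo h₂ n)
  foldr-*-applyUpTo zero    h₁ h₂ f₁ f₂ eq = refl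
  foldr-*-applyUpTo (suc n) h₁ h₂ f₁ f₂ eq =
    cong₂ _*_ (eq 0) (foldr-*-applyUpTo n (λ j → h₁ (suc j)) (λ j → h₂ (suc j)) f₁ f₂ (λ j → eq (suc j)))

  foldr-+-applyUpTo : ∀ n (h₁ h₂ : ℕ → ℕ) (f₁ f₂ : ℕ → ℤ) → (∀ j → f₁ (h₁ j) ≡ f₂ (h₂ j)) →
    foldr (λ i acc → f₁ i + acc) (+ 0) (applyUpTo h₁ n) ≡ foldr (λ i acc → f₂ i + acc) (+ 0) (applyUpTo h₂ n)
  foldr-+-applyUpTo zero    h₁ h₂ f₁ f₂ eq = refl
  foldr-+-applyUpTo (suc n) h₁ h₂ f₁ f₂ eq =
    cong₂ _+_ (eq 0) (foldr-+-applyUpTo n (λ j → h₁ (suc j)) (λ j → h₂ (suc j)) f₁ f₂ (λ j → eq (suc j)))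

  prodFrom-cong : ∀ a n f g → (∀ j → f (a ℕ.+ j) ≡ g (a ℕ.+ j)) → prodFrom a n f ≡ prodFrom a n g
  prodFrom-cong a n f g eq = foldr-*-applyUpTo n (a ℕ.+_) (a ℕ.+_) f g eq

  prodFrom-suc : ∀ a n f → prodFrom a (suc n) f ≡ f a * prodFrom (suc a) n f
  prodFrom-suc a n f =
    cong₂ _*_ (cong f (ℕₚ.+-identityʳ a)) (foldr-*-applyUpTo n _ (suc a ℕ.+_) f f (λ j → cong f (ℕₚ.+-suc a j)))

  prodFrom-shift : ∀ a n f → prodFrom (suc a) n f ≡ prodFrom a n (λ i → f (suc i))
  prodFrom-shift a n f = foldr-*-applyUpTo n (suc a ℕ.+_) (a ℕ.+_) f (λ i → f (suc i)) (λ j → refl)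

  prodFrom-shift-by : ∀ {g h} → (∀ i → h (suc i) ≡ g i) → ∀ a n → prodFrom (suc a) n h ≡ prodFrom a n g
  prodFrom-shift-by {g} {h} eq a n =
    trans (prodFrom-shift a n h) (prodFrom-cong a n (λ i → h (suc i)) g (λ j → eq (a ℕ.+ j)))

  m∸n∸o≡m∸o∸n : ∀ m n o → m ∸ n ∸ o ≡ m ∸ o ∸ n
  m∸n∸o≡m∸o∸n m n o =
    trans (ℕₚ.∸-+-assoc m n o) (trans (cong (m ∸_) (ℕₚ.+-comm n o)) (sym (ℕₚ.∸-+-assoc m o n)))

  prodR-uncons : ∀ x y f → x ≤ y → prodR x y f ≡ f x * prodR (suc x) y f
  prodR-uncons x y f x≤y rewrite ℕₚ.+-∸-assoc 1 x≤y = prodFrom-suc x (y ∸ x) f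

  prodR-empty : ∀ x y f → y < x → prodR x y f ≡ + 1
  prodR-empty x y f y<x rewrite ℕₚ.m≤n⇒m∸n≡0 y<x = refl

  sumR-uncons : ∀ x y f → x ≤ y → sumR x y f ≡ f x + sumR (suc x) y f
  sumR-uncons x y f x≤y rewrite ℕₚ.+-∸-assoc 1 x≤y =
    cong₂ _+_ (cong f (ℕₚ.+-identityʳ x))
              (foldr-+-applyUpTo (y ∸ x) _ (suc x ℕ.+_) f f (λ j → cong f (ℕₚ.+-suc x j)))

  sumR-empty : ∀ x y f → y < x → sumR x y f ≡ + 0
  sumR-empty x y f y<x rewrite ℕₚ.m≤n⇒m∸n≡0 y<x = refl

  sumR-cong : ∀ x y f g → (∀ i → x ≤ i → f i ≡ g i) → sumR x y f ≡ sumR x y g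
  sumR-cong x y f g eq = foldr-+-applyUpTo (suc y ∸ x) (x ℕ.+_) (x ℕ.+_) f g (λ j → eq (x ℕ.+ j) (ℕₚ.m≤m+n x j))

  sumR-*ˡ : ∀ x y c f → sumR x y (λ i → c * f i) ≡ c * sumR x y f
  sumR-*ˡ x y c f = go (suc y ∸ x) (x ℕ.+_)
    where
    go : ∀ n h → foldr (λ i acc → c * f i + acc) (+ 0) (applyUpTo h n)
               ≡ c * foldr (λ i acc → f i + acc) (+ 0) (applyUpTo h n)
    go zero    h = sym (ℤₚ.*-zeroʳ c)
    go (suc n) h = trans (cong (λ w → c * f (h 0) + w) (go n (λ j → h (suc j)))) (sym (ℤₚ.*-distribˡ-+ c _ _))

module ClosedForms where

  import Data.Nat.Properties as ℕₚ
  open import Data.Integer using (ℤ; +_; _+_; _-_; _*_)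
  import Data.Integer.Properties as ℤₚ
  open import Data.Integer.Tactic.RingSolver using (solve-∀)
  open import Relation.Binary.PropositionalEquality
  open ≡-Reasoning
  open Ranges

  m*prodFrom-pred : ∀ m a (g : ℕ → ℤ) → + m * (g a * prodFrom (suc a) (m ∸ 1) g) ≡ + m * prodFrom a m g
  m*prodFrom-pred zero    a g = trans (ℤₚ.*-zeroˡ (g a * + 1)) (sym (ℤₚ.*-zeroˡ (+ 1)))
  m*prodFrom-pred (suc m) a g = cong (+ suc m *_) (sym (prodFrom-suc a m g))

  m*[m∸1]*prodFrom-pred : ∀ m a (g : ℕ → ℤ) →
    + m * + (m ∸ 1) * (g a * prodFrom (suc a) (m ∸ 2) g) ≡ + m * + (m ∸ 1) * prodFrom a (m ∸ 1) g
  m*[m∸1]*prodFrom-pred zero          a g = trans (ℤₚ.*-zeroˡ (g a * + 1)) (sym (ℤₚ.*-zeroˡ (+ 1)))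
  m*[m∸1]*prodFrom-pred (suc zero)    a g = trans (ℤₚ.*-zeroˡ (g a * + 1)) (sym (ℤₚ.*-zeroˡ (+ 1)))
  m*[m∸1]*prodFrom-pred (suc (suc m)) a g = cong (+ suc (suc m) * + suc m *_) (sym (prodFrom-suc a m g))

  m*[m∸1]+m≡m*m : ∀ m → + m * + (m ∸ 1) + + m ≡ + m * + m
  m*[m∸1]+m≡m*m zero    = refl
  m*[m∸1]+m≡m*m (suc m) = lemma (+ m)
    where
    lemma : ∀ k → (+ 1 + k) * k + (+ 1 + k) ≡ (+ 1 + k) * (+ 1 + k)
    lemma = solve-∀

  closedForm₀ : ∀ t (A : ℕ → ℕ → ℤ) g →
    (∀ p → A p 0 ≡ + 1) →
    (∀ p m → t ≤ p → A p (suc m) ≡ g (suc p) * A (suc p) m) →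
    ∀ m p → t ≤ p → A p m ≡ prodFrom (suc p) m g
  closedForm₀ t A g A0 A+ zero    p t≤p = A0 p
  closedForm₀ t A g A0 A+ (suc m) p t≤p = begin
    A p (suc m)                             ≡⟨ A+ p m t≤p ⟩
    g (suc p) * A (suc p) m                 ≡⟨ cong (g (suc p) *_) (closedForm₀ t A g A0 A+ m (suc p) (ℕₚ.m≤n⇒m≤1+n t≤p)) ⟩
    g (suc p) * prodFrom (suc (suc p)) m g  ≡⟨ prodFrom-suc (suc p) m g ⟨
    prodFrom (suc p) (suc m) g              ∎

  closedForm₁ : ∀ t (A : ℕ → ℕ → ℤ) g →
    (∀ p → A p 0 ≡ + 1) →
    (∀ p m → t ≤ p → A p (suc m) ≡ g (suc p) * A (suc p) m + prodFrom (suc p) m g) →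
    ∀ m p → t ≤ p → A p m ≡ prodFrom (suc p) m g + + m * prodFrom (suc p) (m ∸ 1) g
  closedForm₁ t A g A0 A+ zero    p t≤p = A0 p
  closedForm₁ t A g A0 A+ (suc m) p t≤p = begin
    A p (suc m)                              ≡⟨ A+ p m t≤p ⟩
    G * A (suc p) m + C                      ≡⟨ cong (λ u → G * u + C) (closedForm₁ t A g A0 A+ m (suc p) (ℕₚ.m≤n⇒m≤1+n t≤p)) ⟩
    G * (C₁ + + m * C₂) + C                  ≡⟨ expand G C₁ (+ m) C₂ C ⟩
    G * C₁ + + m * (G * C₂) + C              ≡⟨ cong (λ u → G * C₁ + u + C) (m*prodFrom-pred m (suc p) g) ⟩
    G * C₁ + + m * C + C                     ≡⟨ collect G C₁ (+ m) C ⟩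
    G * C₁ + + suc m * C                     ≡⟨ cong (_+ + suc m * C) (prodFrom-suc (suc p) m g) ⟨
    prodFrom (suc p) (suc m) g + + suc m * C ∎
    where
    G = g (suc p)
    C = prodFrom (suc p) m g
    C₁ = prodFrom (suc (suc p)) m g
    C₂ = prodFrom (suc (suc p)) (m ∸ 1) g
    expand : ∀ G C₁ M C₂ C → G * (C₁ + M * C₂) + C ≡ G * C₁ + M * (G * C₂) + C
    expand = solve-∀
    collect : ∀ G C₁ M C → G * C₁ + M * C + C ≡ G * C₁ + (+ 1 + M) * C
    collect = solve-∀

  closedForm₂ : ∀ t (A : ℕ → ℕ → ℤ) g →
    (∀ p → A p 0 ≡ + 1) →
    (∀ p m → t ≤ p → A p (suc m) ≡ g (suc p) * A (suc p) m
                                    + + 2 * (prodFrom (suc p) m g + + m * prodFrom (suc p) (m ∸ 1) g)) →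
    ∀ m p → t ≤ p → A p m ≡ prodFrom (suc p) m g + + 2 * + m * prodFrom (suc p) (m ∸ 1) g
                              + + m * + (m ∸ 1) * prodFrom (suc p) (m ∸ 2) g
  closedForm₂ t A g A0 A+ zero    p t≤p = A0 p
  closedForm₂ t A g A0 A+ (suc m) p t≤p = begin
    A p (suc m)                                                  ≡⟨ A+ p m t≤p ⟩
    G * A (suc p) m + + 2 * (D₁ + M * D₂)
      ≡⟨ cong (λ u → G * u + + 2 * (D₁ + M * D₂)) (closedForm₂ t A g A0 A+ m (suc p) (ℕₚ.m≤n⇒m≤1+n t≤p)) ⟩
    G * (C₁ + + 2 * M * C₂ + M * M′ * C₃) + + 2 * (D₁ + M * D₂)  ≡⟨ expand G C₁ M M′ C₂ C₃ D₁ D₂ ⟩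
    G * C₁ + + 2 * (M * (G * C₂)) + M * M′ * (G * C₃) + + 2 * D₁ + + 2 * (M * D₂)
      ≡⟨ cong₂ (λ u v → G * C₁ + + 2 * u + v + + 2 * D₁ + + 2 * (M * D₂))
               (m*prodFrom-pred m (suc p) g) (m*[m∸1]*prodFrom-pred m (suc p) g) ⟩
    G * C₁ + + 2 * (M * D₁) + M * M′ * D₂ + + 2 * D₁ + + 2 * (M * D₂)
      ≡⟨ regroup G C₁ M M′ D₁ D₂ ⟩
    G * C₁ + + 2 * (+ 1 + M) * D₁ + ((M * M′ + M) * D₂ + M * D₂)
      ≡⟨ cong (λ u → G * C₁ + + 2 * (+ 1 + M) * D₁ + (u * D₂ + M * D₂)) (m*[m∸1]+m≡m*m m) ⟩
    G * C₁ + + 2 * (+ 1 + M) * D₁ + (M * M * D₂ + M * D₂)        ≡⟨ factor G C₁ M D₁ D₂ ⟩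
    G * C₁ + + 2 * (+ 1 + M) * D₁ + (+ 1 + M) * M * D₂
      ≡⟨ cong (λ u → u + + 2 * (+ 1 + M) * D₁ + (+ 1 + M) * M * D₂) (prodFrom-suc (suc p) m g) ⟨
    prodFrom (suc p) (suc m) g + + 2 * + suc m * D₁ + + suc m * M * D₂ ∎
    where
    G = g (suc p)
    M = + m
    M′ = + (m ∸ 1)
    C₁ = prodFrom (suc (suc p)) m g
    C₂ = prodFrom (suc (suc p)) (m ∸ 1) g
    C₃ = prodFrom (suc (suc p)) (m ∸ 2) g
    D₁ = prodFrom (suc p) m g
    D₂ = prodFrom (suc p) (m ∸ 1) g
    expand : ∀ G C₁ M M′ C₂ C₃ D₁ D₂ → G * (C₁ + + 2 * M * C₂ + M * M′ * C₃) + + 2 * (D₁ + M * D₂)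
      ≡ G * C₁ + + 2 * (M * (G * C₂)) + M * M′ * (G * C₃) + + 2 * D₁ + + 2 * (M * D₂)
    expand = solve-∀
    regroup : ∀ G C₁ M M′ D₁ D₂ → G * C₁ + + 2 * (M * D₁) + M * M′ * D₂ + + 2 * D₁ + + 2 * (M * D₂)
      ≡ G * C₁ + + 2 * (+ 1 + M) * D₁ + ((M * M′ + M) * D₂ + M * D₂)
    regroup = solve-∀
    factor : ∀ G C₁ M D₁ D₂ → G * C₁ + + 2 * (+ 1 + M) * D₁ + (M * M * D₂ + M * D₂)
      ≡ G * C₁ + + 2 * (+ 1 + M) * D₁ + (+ 1 + M) * M * D₂
    factor = solve-∀

  isolate : ∀ {X N B E Q P Z H} → X + + 2 * N ≡ B → B + E ≡ Q → N + Z + H ≡ P →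
    X ≡ Q - E - + 2 * (P - Z - H)
  isolate {X} {N} {_} {E} {_} {_} {Z} {H} refl refl refl = identity X N E Z H
    where
    identity : ∀ X N E Z H → X ≡ X + + 2 * N + E - E - + 2 * (N + Z + H - Z - H)
    identity = solve-∀

  *-emptyTail₁ : ∀ t X g → X * (prodR (suc t) t g + + (t ∸ t) * prodR (suc t) (t ∸ 1) g) ≡ X
  *-emptyTail₁ t X g =
    trans (cong₂ (λ u v → X * (u + + v * A)) (prodR-empty (suc t) t g (ℕₚ.n<1+n t)) (ℕₚ.n∸n≡0 t)) (identity X A)
    where
    A = prodR (suc t) (t ∸ 1) g
    identity : ∀ X A → X * (+ 1 + + 0 * A) ≡ X
    identity = solve-∀

  *-emptyTail₂ : ∀ t X P S g h →
    X * (P * (prodR (suc t) t g + + 2 * + (t ∸ t) * prodR (suc t) (t ∸ 1) g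
              + + (t ∸ t) * + (t ∸ t ∸ 1) * prodR (suc t) (t ∸ 2) g)
         + S * (prodR (suc t) t h + + (t ∸ t) * prodR (suc t) (t ∸ 1) h))
    ≡ X * (P + S)
  *-emptyTail₂ t X P S g h =
    trans (cong (λ v → X * (P * (G + + 2 * + v * A + + v * + (v ∸ 1) * B) + S * (H + + v * C))) (ℕₚ.n∸n≡0 t))
      (trans (cong₂ (λ u w → X * (P * (u + + 2 * + 0 * A + + 0 * + 0 * B) + S * (w + + 0 * C)))
                    (prodR-empty (suc t) t g (ℕₚ.n<1+n t)) (prodR-empty (suc t) t h (ℕₚ.n<1+n t)))
             (identity X P S A B C))
    where
    G = prodR (suc t) t g
    H = prodR (suc t) t h
    A = prodR (suc t) (t ∸ 1) g
    B = prodR (suc t) (t ∸ 2) g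
    C = prodR (suc t) (t ∸ 1) h
    identity : ∀ X P S A B C → X * (P * (+ 1 + + 2 * + 0 * A + + 0 * + 0 * B) + S * (+ 1 + + 0 * C)) ≡ X * (P + S)
    identity = solve-∀

module Factors (q t : ℕ) (d : ℕ → ℕ) where

  import Data.Nat as ℕ
  open import Data.Integer using (ℤ; +_; _+_; _-_; _*_)
  import Data.Integer.Properties as ℤₚ
  open import Data.Integer.Tactic.RingSolver using (solve-∀)
  open import Relation.Binary.PropositionalEquality

  Q : ℤ
  Q = + q

  baseFactor : ℕ → ℤ
  baseFactor i = Q - + (2 ℕ.* i)

  headFactor : ℤ → ℕ → ℤ
  headFactor c i = Q - + d i - + (2 ℕ.* i) + c

  tailFactor : ℤ → ℕ → ℤ
  tailFactor c i = Q - + (2 ℕ.* i) + c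

  tailFactor-suc : ∀ c i → tailFactor (c + + 2) (suc i) ≡ tailFactor c i
  tailFactor-suc c i rewrite ℤₚ.pos-* 2 (suc i) | ℤₚ.pos-* 2 i = shift Q c (+ i)
    where
    shift : ∀ Q c I → Q - + 2 * (+ 1 + I) + (c + + 2) ≡ Q - + 2 * I + c
    shift = solve-∀

  halfPlacement : ℕ → ℕ → ℤ
  halfPlacement p i = prodR (suc p) (i ∸ 1) (headFactor (+ 1)) * prodR (suc i) t (headFactor (+ 3))

  halfPlacements : ℕ → ℤ
  halfPlacements p = sumR (suc p) t (halfPlacement p)

module Ways (q t : ℕ) (qEven : Bool) (sEven : ℕ → Bool) (d : ℕ → ℕ) where

  open import Data.Nat using (_<ᵇ_)
  open import Data.Integer using (ℤ; +_; _+_; _-_; _*_)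
  import Data.Integer.Properties as ℤₚ
  open import Data.Integer.Tactic.RingSolver using (solve-∀)
  open import Data.Bool using (true; false; _∧_; not; if_then_else_)
  open import Relation.Binary.PropositionalEquality
  open Count using (𝟙)
  open Booleans
  open Factors q t d public

  -- After an admissible prefix of length p, z and h record whether 0 and q/2 occur in it; in
  -- step b p z h W, b says whether p < t and W z′ h′ counts the continuations from the next state.
  halfAllowed : ℕ → Bool
  halfAllowed p = qEven ∧ not (sEven (suc p))

  excluded : Bool → ℕ → ℤ
  excluded true  p = + d (suc p) + + 𝟙 (halfAllowed p)
  excluded false p = + 1 + + 𝟙 qEven

  zeroFree : Bool → Bool → Bool
  zeroFree true  z = false
  zeroFree false z = not z

  halfFree : Bool → ℕ → Bool → Bool
  halfFree true  p h = halfAllowed p ∧ not h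
  halfFree false p h = qEven ∧ not h

  genericFree : Bool → ℕ → Bool → Bool → ℤ
  genericFree b p z h = Q - excluded b p - + 2 * (+ p - + 𝟙 z - + 𝟙 h)

  step : Bool → ℕ → Bool → Bool → (Bool → Bool → ℤ) → ℤ
  step b p z h W = genericFree b p z h * W z h
                 + (if zeroFree b z then W true h else + 0)
                 + (if halfFree b p h then W z true else + 0)

  ways : ℕ → ℕ → Bool → Bool → ℤ
  ways p zero    z h = + 1
  ways p (suc m) z h = step (p <ᵇ t) p z h (ways (suc p) m)

  -- step before and after position t, with the generic coefficient put in the shape of the closed form
  headStep : Bool → ℕ → Bool → Bool → (Bool → Bool → ℤ) → ℤ
  headStep x p z h W = headFactor (+ 2 - + 𝟙 x + + 2 * (+ 𝟙 z + + 𝟙 h)) (suc p) * W z h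
                     + (if x ∧ not h then W z true else + 0)

  tailStep : ℕ → Bool → Bool → (Bool → Bool → ℤ) → ℤ
  tailStep p z h W = tailFactor (+ 1 - + 𝟙 qEven + + 2 * (+ 𝟙 z + + 𝟙 h)) (suc p) * W z h
                   + (if not z then W true h else + 0)
                   + (if qEven ∧ not h then W z true else + 0)

  ways-head : ∀ {p} m z h → p < t → ways p (suc m) z h ≡ headStep (halfAllowed p) p z h (ways (suc p) m)
  ways-head {p} m z h p<t rewrite <ᵇ-true p<t | ℤₚ.pos-* 2 (suc p) =
    regroup Q (+ d (suc p)) (+ 𝟙 (halfAllowed p)) (+ p) (+ 𝟙 z) (+ 𝟙 h) (ways (suc p) m z h) _
    where
    regroup : ∀ Q D X P Z H W V → (Q - (D + X) - + 2 * (P - Z - H)) * W + + 0 + V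
                                ≡ (Q - D - + 2 * (+ 1 + P) + (+ 2 - X + + 2 * (Z + H))) * W + V
    regroup = solve-∀

  ways-tail : ∀ {p} m z h → t ≤ p → ways p (suc m) z h ≡ tailStep p z h (ways (suc p) m)
  ways-tail {p} m z h t≤p rewrite <ᵇ-false t≤p | ℤₚ.pos-* 2 (suc p) =
    cong (λ x → x * ways (suc p) m z h + (if not z then ways (suc p) m true h else + 0)
                                       + (if qEven ∧ not h then ways (suc p) m z true else + 0))
         (regroup Q (+ 𝟙 qEven) (+ p) (+ 𝟙 z) (+ 𝟙 h))
    where
    regroup : ∀ Q E P Z H → Q - (+ 1 + E) - + 2 * (P - Z - H) ≡ Q - + 2 * (+ 1 + P) + (+ 1 - E + + 2 * (Z + H))
    regroup = solve-∀

module Head (q t : ℕ) (qEven : Bool) (sEven : ℕ → Bool) (d : ℕ → ℕ) where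

  open import Data.Nat as ℕ using (z≤n; s≤s)
  import Data.Nat.Properties as ℕₚ
  open import Data.Integer using (+_; _+_; _*_)
  import Data.Integer.Properties as ℤₚ
  open import Data.Integer.Tactic.RingSolver using (solve-∀)
  open import Data.Bool using (true; false)
  open import Relation.Binary.PropositionalEquality
  open ≡-Reasoning
  open Ranges
  open Ways q t qEven sEven d

  head-halfForbidden : ∀ j p m → p ℕ.+ j ≤ t → (∀ i → p ≤ i → i < p ℕ.+ j → halfAllowed i ≡ false) →
    ways p (j ℕ.+ m) false false ≡ prodFrom (suc p) j (headFactor (+ 2)) * ways (p ℕ.+ j) m false false
  head-halfForbidden zero    p m _ _ =
    sym (trans (ℤₚ.*-identityˡ _) (cong (λ x → ways x m false false) (ℕₚ.+-identityʳ p)))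
  head-halfForbidden (suc j) p m p+j≤t forbidden = begin
    ways p (suc (j ℕ.+ m)) false false
      ≡⟨ ways-head (j ℕ.+ m) false false p<t ⟩
    headStep (halfAllowed p) p false false (ways (suc p) (j ℕ.+ m))
      ≡⟨ cong (λ x → headStep x p false false (ways (suc p) (j ℕ.+ m))) (forbidden p ℕₚ.≤-refl p<p+j) ⟩
    X * ways (suc p) (j ℕ.+ m) false false + + 0
      ≡⟨ cong (λ w → X * w + + 0) IH ⟩
    X * (prodFrom (suc (suc p)) j (headFactor (+ 2)) * ways (suc p ℕ.+ j) m false false) + + 0
      ≡⟨ regroup X _ _ ⟩
    X * prodFrom (suc (suc p)) j (headFactor (+ 2)) * ways (suc p ℕ.+ j) m false false
      ≡⟨ cong₂ (λ u v → u * ways v m false false) (prodFrom-suc (suc p) j (headFactor (+ 2))) (ℕₚ.+-suc p j) ⟨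
    prodFrom (suc p) (suc j) (headFactor (+ 2)) * ways (p ℕ.+ suc j) m false false ∎
    where
    X = headFactor (+ 2) (suc p)
    p<p+j : p < p ℕ.+ suc j
    p<p+j = ℕₚ.m<m+n p (s≤s z≤n)
    p<t : p < t
    p<t = ℕₚ.<-≤-trans p<p+j p+j≤t
    IH = head-halfForbidden j (suc p) m (subst (_≤ t) (ℕₚ.+-suc p j) p+j≤t)
           (λ i p<i i<p+j → forbidden i (ℕₚ.<⇒≤ p<i) (subst (i <_) (sym (ℕₚ.+-suc p j)) i<p+j))
    regroup : ∀ X P W → X * (P * W) + + 0 ≡ X * P * W
    regroup = solve-∀

  head-halfUsed : ∀ j p m → p ℕ.+ j ≡ t → (∀ i → p ≤ i → i < t → halfAllowed i ≡ true) →
    ways p (j ℕ.+ m) false true ≡ prodR (suc p) t (headFactor (+ 3)) * ways t m false true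
  head-halfUsed zero    p m p≡t _ = sym (begin
    prodR (suc p) t (headFactor (+ 3)) * ways t m false true
      ≡⟨ cong (_* ways t m false true) (prodR-empty (suc p) t (headFactor (+ 3)) (s≤s (ℕₚ.≤-reflexive (sym p≡t′)))) ⟩
    + 1 * ways t m false true   ≡⟨ ℤₚ.*-identityˡ _ ⟩
    ways t m false true         ≡⟨ cong (λ x → ways x m false true) p≡t′ ⟨
    ways p m false true         ∎)
    where p≡t′ = trans (sym (ℕₚ.+-identityʳ p)) p≡t
  head-halfUsed (suc j) p m p+j≡t allowed = begin
    ways p (suc (j ℕ.+ m)) false true
      ≡⟨ ways-head (j ℕ.+ m) false true p<t ⟩
    headStep (halfAllowed p) p false true (ways (suc p) (j ℕ.+ m))
      ≡⟨ cong (λ x → headStep x p false true (ways (suc p) (j ℕ.+ m))) (allowed p ℕₚ.≤-refl p<t) ⟩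
    X * ways (suc p) (j ℕ.+ m) false true + + 0
      ≡⟨ cong (λ w → X * w + + 0) (head-halfUsed j (suc p) m sp+j≡t (λ i p<i → allowed i (ℕₚ.<⇒≤ p<i))) ⟩
    X * (prodR (suc (suc p)) t (headFactor (+ 3)) * ways t m false true) + + 0
      ≡⟨ regroup X _ _ ⟩
    X * prodR (suc (suc p)) t (headFactor (+ 3)) * ways t m false true
      ≡⟨ cong (_* ways t m false true) (prodR-uncons (suc p) t (headFactor (+ 3)) p<t) ⟨
    prodR (suc p) t (headFactor (+ 3)) * ways t m false true ∎
    where
    X = headFactor (+ 3) (suc p)
    sp+j≡t : suc p ℕ.+ j ≡ t
    sp+j≡t = trans (sym (ℕₚ.+-suc p j)) p+j≡t
    p<t : p < t
    p<t = subst (suc p ≤_) sp+j≡t (ℕₚ.m≤m+n (suc p) j)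
    regroup : ∀ X P W → X * (P * W) + + 0 ≡ X * P * W
    regroup = solve-∀

  halfPlacements-suc : ∀ p → suc p ≤ t →
    halfPlacements p ≡ prodR (suc (suc p)) t (headFactor (+ 3)) + headFactor (+ 1) (suc p) * halfPlacements (suc p)
  halfPlacements-suc p p<t = begin
    halfPlacements p
      ≡⟨ sumR-uncons (suc p) t (halfPlacement p) p<t ⟩
    halfPlacement p (suc p) + sumR (suc (suc p)) t (halfPlacement p)
      ≡⟨ cong₂ _+_ (trans (cong (_* B) (prodR-empty (suc p) p (headFactor (+ 1)) ℕₚ.≤-refl)) (ℤₚ.*-identityˡ B))
                   (sumR-cong (suc (suc p)) t (halfPlacement p) (λ i → X * halfPlacement (suc p) i) uncons) ⟩
    B + sumR (suc (suc p)) t (λ i → X * halfPlacement (suc p) i)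
      ≡⟨ cong (λ w → B + w) (sumR-*ˡ (suc (suc p)) t X (halfPlacement (suc p))) ⟩
    B + X * halfPlacements (suc p) ∎
    where
    X = headFactor (+ 1) (suc p)
    B = prodR (suc (suc p)) t (headFactor (+ 3))
    uncons : ∀ i → suc (suc p) ≤ i → halfPlacement p i ≡ X * halfPlacement (suc p) i
    uncons (suc i) (s≤s p<i) =
      trans (cong (_* prodR (suc (suc i)) t (headFactor (+ 3))) (prodR-uncons (suc p) i (headFactor (+ 1)) p<i))
            (ℤₚ.*-assoc X _ _)

  head-halfAllowed : ∀ j p m → p ℕ.+ j ≡ t → (∀ i → p ≤ i → i < t → halfAllowed i ≡ true) →
    ways p (j ℕ.+ m) false false
      ≡ prodR (suc p) t (headFactor (+ 1)) * ways t m false false + halfPlacements p * ways t m false true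
  head-halfAllowed zero    p m p≡t _ = sym (begin
    prodR (suc p) t (headFactor (+ 1)) * ways t m false false + halfPlacements p * ways t m false true
      ≡⟨ cong₂ (λ u v → u * ways t m false false + v * ways t m false true)
               (prodR-empty (suc p) t (headFactor (+ 1)) t<sp) (sumR-empty (suc p) t (halfPlacement p) t<sp) ⟩
    + 1 * ways t m false false + + 0 * ways t m false true
      ≡⟨ simplify (ways t m false false) (ways t m false true) ⟩
    ways t m false false
      ≡⟨ cong (λ x → ways x m false false) p≡t′ ⟨
    ways p m false false ∎)
    where
    p≡t′ = trans (sym (ℕₚ.+-identityʳ p)) p≡t
    t<sp = s≤s (ℕₚ.≤-reflexive (sym p≡t′))
    simplify : ∀ W W′ → + 1 * W + + 0 * W′ ≡ W
    simplify = solve-∀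
  head-halfAllowed (suc j) p m p+j≡t allowed = begin
    ways p (suc (j ℕ.+ m)) false false
      ≡⟨ ways-head (j ℕ.+ m) false false p<t ⟩
    headStep (halfAllowed p) p false false (ways (suc p) (j ℕ.+ m))
      ≡⟨ cong (λ x → headStep x p false false (ways (suc p) (j ℕ.+ m))) (allowed p ℕₚ.≤-refl p<t) ⟩
    X * ways (suc p) (j ℕ.+ m) false false + ways (suc p) (j ℕ.+ m) false true
      ≡⟨ cong₂ (λ u v → X * u + v) (head-halfAllowed j (suc p) m sp+j≡t allowed′) (head-halfUsed j (suc p) m sp+j≡t allowed′) ⟩
    X * (A * R + halfPlacements (suc p) * R′) + B * R′
      ≡⟨ regroup X A R (halfPlacements (suc p)) R′ B ⟩
    X * A * R + (B + X * halfPlacements (suc p)) * R′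
      ≡⟨ cong₂ (λ u v → u * R + v * R′) (prodR-uncons (suc p) t (headFactor (+ 1)) p<t) (halfPlacements-suc p p<t) ⟨
    prodR (suc p) t (headFactor (+ 1)) * R + halfPlacements p * R′ ∎
    where
    X = headFactor (+ 1) (suc p)
    A = prodR (suc (suc p)) t (headFactor (+ 1))
    B = prodR (suc (suc p)) t (headFactor (+ 3))
    R = ways t m false false
    R′ = ways t m false true
    sp+j≡t : suc p ℕ.+ j ≡ t
    sp+j≡t = trans (sym (ℕₚ.+-suc p j)) p+j≡t
    p<t : p < t
    p<t = subst (suc p ≤_) sp+j≡t (ℕₚ.m≤m+n (suc p) j)
    allowed′ : ∀ i → suc p ≤ i → i < t → halfAllowed i ≡ true
    allowed′ i p<i = allowed i (ℕₚ.<⇒≤ p<i)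
    regroup : ∀ X A R S R′ B → X * (A * R + S * R′) + B * R′ ≡ X * A * R + (B + X * S) * R′
    regroup = solve-∀

module OddWays (q t : ℕ) (sEven : ℕ → Bool) (d : ℕ → ℕ) where

  import Data.Nat as ℕ
  import Data.Nat.Properties as ℕₚ
  open import Data.Integer using (+_; _+_; _*_)
  import Data.Integer.Properties as ℤₚ
  open import Data.Bool using (true; false)
  open import Relation.Binary.PropositionalEquality
  open Ranges
  open ≡-Reasoning
  open ClosedForms
  open Ways q t false sEven d

  tail-zeroUsed : ∀ m p → t ≤ p → ways p m true false ≡ prodFrom (suc p) m (tailFactor (+ 3))
  tail-zeroUsed = closedForm₀ t (λ p m → ways p m true false) (tailFactor (+ 3)) (λ _ → refl)
    (λ p m t≤p → trans (ways-tail m true false t≤p) (trans (ℤₚ.+-identityʳ _) (ℤₚ.+-identityʳ _)))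

  tail-fresh : ∀ m p → t ≤ p → ways p m false false
    ≡ prodFrom (suc p) m (tailFactor (+ 1)) + + m * prodFrom (suc p) (m ∸ 1) (tailFactor (+ 1))
  tail-fresh = closedForm₁ t (λ p m → ways p m false false) (tailFactor (+ 1)) (λ _ → refl)
    (λ p m t≤p → trans (ways-tail m false false t≤p)
      (trans (ℤₚ.+-identityʳ _)
        (cong (λ w → tailFactor (+ 1) (suc p) * ways (suc p) m false false + w)
          (trans (tail-zeroUsed m (suc p) (ℕₚ.m≤n⇒m≤1+n t≤p))
                 (prodFrom-shift-by {h = tailFactor (+ 3)} (tailFactor-suc (+ 1)) (suc p) m)))))

  open Head q t false sEven d using (head-halfForbidden)

  ways-closedForm : ∀ {m} → t ≤ m → ways 0 m false false
    ≡ prodR 1 t (headFactor (+ 2))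
      * (prodR (suc t) m (tailFactor (+ 1)) + + (m ∸ t) * prodR (suc t) (m ∸ 1) (tailFactor (+ 1)))
  ways-closedForm {m} t≤m = begin
    ways 0 m false false
      ≡⟨ cong (λ n → ways 0 n false false) (ℕₚ.m+[n∸m]≡n t≤m) ⟨
    ways 0 (t ℕ.+ (m ∸ t)) false false
      ≡⟨ head-halfForbidden t 0 (m ∸ t) ℕₚ.≤-refl (λ _ _ _ → refl) ⟩
    prodFrom 1 t (headFactor (+ 2)) * ways t (m ∸ t) false false
      ≡⟨ cong (prodFrom 1 t (headFactor (+ 2)) *_) (tail-fresh (m ∸ t) t ℕₚ.≤-refl) ⟩
    prodFrom 1 t (headFactor (+ 2))
      * (prodFrom (suc t) (m ∸ t) g + + (m ∸ t) * prodFrom (suc t) (m ∸ t ∸ 1) g)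
      ≡⟨ cong (λ n → prodFrom 1 t (headFactor (+ 2)) * (prodFrom (suc t) (m ∸ t) g + + (m ∸ t) * prodFrom (suc t) n g))
              (m∸n∸o≡m∸o∸n m t 1) ⟩
    prodR 1 t (headFactor (+ 2))
      * (prodR (suc t) m g + + (m ∸ t) * prodR (suc t) (m ∸ 1) g) ∎
    where
    g = tailFactor (+ 1)

module EvenWays (q t : ℕ) (sEven : ℕ → Bool) (d : ℕ → ℕ) where

  import Data.Nat as ℕ
  import Data.Nat.Properties as ℕₚ
  open import Data.Integer using (+_; _+_; _*_)
  import Data.Integer.Properties as ℤₚ
  open import Data.Integer.Tactic.RingSolver using (solve-∀)
  open import Data.Bool using (true; false)
  open import Relation.Binary.PropositionalEquality
  open ≡-Reasoning
  open Ranges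
  open ClosedForms
  open Ways q t true sEven d

  tail-bothUsed : ∀ m p → t ≤ p → ways p m true true ≡ prodFrom (suc p) m (tailFactor (+ 4))
  tail-bothUsed = closedForm₀ t (λ p m → ways p m true true) (tailFactor (+ 4)) (λ _ → refl)
    (λ p m t≤p → trans (ways-tail m true true t≤p) (trans (ℤₚ.+-identityʳ _) (ℤₚ.+-identityʳ _)))

  tail-bothUsed-next : ∀ m p → t ≤ p → ways (suc p) m true true ≡ prodFrom (suc p) m (tailFactor (+ 2))
  tail-bothUsed-next m p t≤p = trans (tail-bothUsed m (suc p) (ℕₚ.m≤n⇒m≤1+n t≤p))
    (prodFrom-shift-by {h = tailFactor (+ 4)} (tailFactor-suc (+ 2)) (suc p) m)

  tail-zeroUsed : ∀ m p → t ≤ p → ways p m true false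
    ≡ prodFrom (suc p) m (tailFactor (+ 2)) + + m * prodFrom (suc p) (m ∸ 1) (tailFactor (+ 2))
  tail-zeroUsed = closedForm₁ t (λ p m → ways p m true false) (tailFactor (+ 2)) (λ _ → refl)
    (λ p m t≤p → trans (ways-tail m true false t≤p)
      (cong₂ _+_ (ℤₚ.+-identityʳ (tailFactor (+ 2) (suc p) * ways (suc p) m true false))
                 (tail-bothUsed-next m p t≤p)))

  tail-halfUsed : ∀ m p → t ≤ p → ways p m false true
    ≡ prodFrom (suc p) m (tailFactor (+ 2)) + + m * prodFrom (suc p) (m ∸ 1) (tailFactor (+ 2))
  tail-halfUsed = closedForm₁ t (λ p m → ways p m false true) (tailFactor (+ 2)) (λ _ → refl)
    (λ p m t≤p → trans (ways-tail m false true t≤p)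
      (trans (ℤₚ.+-identityʳ _)
        (cong (λ w → tailFactor (+ 2) (suc p) * ways (suc p) m false true + w) (tail-bothUsed-next m p t≤p))))

  tail-fresh : ∀ m p → t ≤ p → ways p m false false
    ≡ prodFrom (suc p) m baseFactor + + 2 * + m * prodFrom (suc p) (m ∸ 1) baseFactor
      + + m * + (m ∸ 1) * prodFrom (suc p) (m ∸ 2) baseFactor
  tail-fresh = closedForm₂ t (λ p m → ways p m false false) baseFactor (λ _ → refl) recurrence
    where
    tail-zeroUsed-next : ∀ m p → t ≤ p →
      ways (suc p) m true false ≡ prodFrom (suc p) m baseFactor + + m * prodFrom (suc p) (m ∸ 1) baseFactor
    tail-zeroUsed-next m p t≤p = trans (tail-zeroUsed m (suc p) (ℕₚ.m≤n⇒m≤1+n t≤p))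
      (cong₂ (λ u v → u + + m * v) (prodFrom-shift-by {h = tailFactor (+ 2)} eq (suc p) m)
                                  (prodFrom-shift-by {h = tailFactor (+ 2)} eq (suc p) (m ∸ 1)))
      where
      eq : ∀ i → tailFactor (+ 2) (suc i) ≡ baseFactor i
      eq i = trans (tailFactor-suc (+ 0) i) (ℤₚ.+-identityʳ _)
    tail-halfUsed≡zeroUsed : ∀ m p → t ≤ p → ways (suc p) m false true ≡ ways (suc p) m true false
    tail-halfUsed≡zeroUsed m p t≤p =
      trans (tail-halfUsed m (suc p) (ℕₚ.m≤n⇒m≤1+n t≤p)) (sym (tail-zeroUsed m (suc p) (ℕₚ.m≤n⇒m≤1+n t≤p)))
    double : ∀ x → x + x ≡ + 2 * x
    double = solve-∀
    recurrence : ∀ p m → t ≤ p → ways p (suc m) false false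
      ≡ baseFactor (suc p) * ways (suc p) m false false
        + + 2 * (prodFrom (suc p) m baseFactor + + m * prodFrom (suc p) (m ∸ 1) baseFactor)
    recurrence p m t≤p = begin
      ways p (suc m) false false
        ≡⟨ ways-tail m false false t≤p ⟩
      tailFactor (+ 0) (suc p) * W false false + W true false + W false true
        ≡⟨ cong (λ x → x * W false false + W true false + W false true) (ℤₚ.+-identityʳ (baseFactor (suc p))) ⟩
      baseFactor (suc p) * W false false + W true false + W false true
        ≡⟨ cong (λ w → baseFactor (suc p) * W false false + W true false + w) (tail-halfUsed≡zeroUsed m p t≤p) ⟩
      baseFactor (suc p) * W false false + W true false + W true false
        ≡⟨ ℤₚ.+-assoc (baseFactor (suc p) * W false false) _ _ ⟩
      baseFactor (suc p) * W false false + (W true false + W true false)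
        ≡⟨ cong (λ w → baseFactor (suc p) * W false false + w)
                (trans (double (W true false)) (cong (+ 2 *_) (tail-zeroUsed-next m p t≤p))) ⟩
      baseFactor (suc p) * W false false + + 2 * (prodFrom (suc p) m baseFactor + + m * prodFrom (suc p) (m ∸ 1) baseFactor) ∎
      where W = ways (suc p) m

  open Head q t true sEven d using (head-halfForbidden; head-halfAllowed)

  ways-closedForm : ∀ {r m} → r ≤ t → t ≤ m →
    (∀ i → i < r → halfAllowed i ≡ false) → (∀ i → r ≤ i → i < t → halfAllowed i ≡ true) →
    ways 0 m false false
      ≡ prodR 1 r (headFactor (+ 2))
        * (prodR (suc r) t (headFactor (+ 1))
             * (prodR (suc t) m baseFactor + + 2 * + (m ∸ t) * prodR (suc t) (m ∸ 1) baseFactor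
                + + (m ∸ t) * + (m ∸ t ∸ 1) * prodR (suc t) (m ∸ 2) baseFactor)
           + halfPlacements r * (prodR (suc t) m (tailFactor (+ 2)) + + (m ∸ t) * prodR (suc t) (m ∸ 1) (tailFactor (+ 2))))
  ways-closedForm {r} {m} r≤t t≤m forbidden allowed = begin
    ways 0 m false false
      ≡⟨ cong (λ n → ways 0 n false false) m≡r+[t∸r]+[m∸t] ⟩
    ways 0 (r ℕ.+ ((t ∸ r) ℕ.+ (m ∸ t))) false false
      ≡⟨ head-halfForbidden r 0 _ r≤t (λ i _ → forbidden i) ⟩
    prodFrom 1 r (headFactor (+ 2)) * ways r ((t ∸ r) ℕ.+ (m ∸ t)) false false
      ≡⟨ cong (prodFrom 1 r (headFactor (+ 2)) *_) (head-halfAllowed (t ∸ r) r (m ∸ t) (ℕₚ.m+[n∸m]≡n r≤t) allowed) ⟩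
    prodFrom 1 r (headFactor (+ 2))
      * (prodR (suc r) t (headFactor (+ 1)) * ways t (m ∸ t) false false + halfPlacements r * ways t (m ∸ t) false true)
      ≡⟨ cong₂ (λ u v → prodFrom 1 r (headFactor (+ 2)) * (prodR (suc r) t (headFactor (+ 1)) * u + halfPlacements r * v))
               (tail-fresh (m ∸ t) t ℕₚ.≤-refl) (tail-halfUsed (m ∸ t) t ℕₚ.≤-refl) ⟩
    prodFrom 1 r (headFactor (+ 2))
      * (prodR (suc r) t (headFactor (+ 1))
           * (prodFrom (suc t) (m ∸ t) baseFactor + + 2 * + (m ∸ t) * prodFrom (suc t) (m ∸ t ∸ 1) baseFactor
              + + (m ∸ t) * + (m ∸ t ∸ 1) * prodFrom (suc t) (m ∸ t ∸ 2) baseFactor)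
         + halfPlacements r * (prodFrom (suc t) (m ∸ t) g + + (m ∸ t) * prodFrom (suc t) (m ∸ t ∸ 1) g))
      ≡⟨ cong₂ (λ n₁ n₂ → prodFrom 1 r (headFactor (+ 2))
                 * (prodR (suc r) t (headFactor (+ 1))
                      * (prodFrom (suc t) (m ∸ t) baseFactor + + 2 * + (m ∸ t) * prodFrom (suc t) n₁ baseFactor
                         + + (m ∸ t) * + (m ∸ t ∸ 1) * prodFrom (suc t) n₂ baseFactor)
                    + halfPlacements r * (prodFrom (suc t) (m ∸ t) g + + (m ∸ t) * prodFrom (suc t) n₁ g)))
               (m∸n∸o≡m∸o∸n m t 1) (m∸n∸o≡m∸o∸n m t 2) ⟩
    prodR 1 r (headFactor (+ 2))
      * (prodR (suc r) t (headFactor (+ 1))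
           * (prodR (suc t) m baseFactor + + 2 * + (m ∸ t) * prodR (suc t) (m ∸ 1) baseFactor
              + + (m ∸ t) * + (m ∸ t ∸ 1) * prodR (suc t) (m ∸ 2) baseFactor)
         + halfPlacements r * (prodR (suc t) m g + + (m ∸ t) * prodR (suc t) (m ∸ 1) g)) ∎
    where
    g = tailFactor (+ 2)
    m≡r+[t∸r]+[m∸t] : m ≡ r ℕ.+ ((t ∸ r) ℕ.+ (m ∸ t))
    m≡r+[t∸r]+[m∸t] = sym (trans (sym (ℕₚ.+-assoc r (t ∸ r) (m ∸ t)))
                                 (trans (cong (ℕ._+ (m ∸ t)) (ℕₚ.m+[n∸m]≡n r≤t)) (ℕₚ.m+[n∸m]≡n t≤m)))

module Residues (q : ℕ) (q>0 : 0 < q) (t : ℕ) (s : ℕ → ℕ)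
                (s-chain : ∀ j p → j ≤ p → p < t → s (suc p) ∣ s (suc j)) where

  open import Data.Nat as ℕ using (_+_; _*_; _≡ᵇ_; _<ᵇ_; z≤n; s≤s)
  import Data.Nat.Properties as ℕₚ
  open import Data.Nat.Divisibility
    using (_∣?_; divides; ∣m+n∣m⇒∣n; n∣n; _∣0; ∣-trans; ∣⇒≤; *-monoˡ-∣; n∣m*n)
  open import Data.Integer as ℤ using (ℤ; +_)
  import Data.Integer.Properties as ℤₚ
  open import Data.Bool using (true; false; if_then_else_; _∧_; _∨_; not)
  import Data.Bool.Properties as Boolₚ
  open import Data.List using (List; []; _∷_; length)
  open import Data.Empty using (⊥-elim)
  open import Data.Unit using (⊤; tt)
  open import Data.Sum using (_⊎_; inj₁; inj₂)
  open import Data.Product using (_×_; _,_)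
  open import Relation.Nullary using (yes; no; does)
  open import Relation.Nullary.Decidable using (dec-true; dec-false)
  open import Relation.Binary.PropositionalEquality
  open import Relation.Binary.Definitions using (tri<; tri≈; tri>)
  open ≡-Reasoning
  open Booleans
  open Count
  open ClosedForms using (isolate)
  open import Data.Nat.Tactic.RingSolver using (solve-∀)

  data Parity : Bool → Set where
    even : ∀ h → q ≡ h + h → Parity true
    odd  : (∀ a → a + a ≢ q) → Parity false

  multiple : ℕ → Bool
  multiple n = does (q ∣? n)

  ∤-positive : ∀ {n} → 0 < n → n < q → ¬ q ∣ n
  ∤-positive {suc n} _ n<q q∣n = ℕₚ.<-irrefl refl (ℕₚ.<-≤-trans n<q (∣⇒≤ q∣n))

  ∣-below-2q : ∀ n → n < q + q → q ∣ n → n ≡ 0 ⊎ n ≡ q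
  ∣-below-2q n n<2q (divides zero          n≡0)    = inj₁ n≡0
  ∣-below-2q n n<2q (divides (suc zero)    n≡q+0)  = inj₂ (trans n≡q+0 (ℕₚ.+-identityʳ q))
  ∣-below-2q n n<2q (divides (suc (suc k)) n≡kq) =
    ⊥-elim (ℕₚ.<-irrefl refl
      (ℕₚ.<-≤-trans n<2q (subst (q + q ≤_) (sym n≡kq) (ℕₚ.+-monoʳ-≤ q (ℕₚ.m≤m+n q (k * q))))))

  ∣-sum-of-residues : ∀ a b → a < q → b < q → q ∣ a + b → (a ≡ 0 × b ≡ 0) ⊎ a + b ≡ q
  ∣-sum-of-residues a b a<q b<q q∣a+b with ∣-below-2q (a + b) (ℕₚ.+-mono-< a<q b<q) q∣a+b
  ... | inj₁ a+b≡0 = inj₁ (ℕₚ.m+n≡0⇒m≡0 a a+b≡0 , ℕₚ.m+n≡0⇒n≡0 a a+b≡0)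
  ... | inj₂ a+b≡q = inj₂ a+b≡q

  double-injective : ∀ {a b} → a + a ≡ b + b → a ≡ b
  double-injective {a} {b} eq with ℕₚ.<-cmp a b
  ... | tri≈ _ a≡b _ = a≡b
  ... | tri< a<b _ _ = ⊥-elim (ℕₚ.<-irrefl eq (ℕₚ.+-mono-< a<b a<b))
  ... | tri> _ _ b<a = ⊥-elim (ℕₚ.<-irrefl (sym eq) (ℕₚ.+-mono-< b<a b<a))

  -- Positions are 0-based: the entry at position p meets the column s (suc p) eₚ, present only if p < t.
  annihilates : ℕ → ℕ → Bool
  annihilates p a = multiple (s (suc p) * a)

  killed : ℕ → ℕ → Bool
  killed p a = (p <ᵇ t) ∧ annihilates p a

  compatible : ℕ → ℕ → Bool
  compatible a y = not (a ≡ᵇ y) ∧ not (multiple (a + y))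

  compatibleWith : ℕ → List ℕ → Bool
  compatibleWith a []       = true
  compatibleWith a (y ∷ ys) = compatible a y ∧ compatibleWith a ys

  admissible : List ℕ → ℕ → Bool
  admissible xs a = not (killed (length xs) a) ∧ compatibleWith a xs

  hasZero : List ℕ → Bool
  hasZero []       = false
  hasZero (y ∷ ys) = (y ≡ᵇ 0) ∨ hasZero ys

  hasHalf : List ℕ → Bool
  hasHalf []       = false
  hasHalf (y ∷ ys) = ((y + y) ≡ᵇ q) ∨ hasHalf ys

  -- A prefix x₁, …, xₚ is stored reversed, as xₚ ∷ … ∷ x₁ ∷ [].
  Valid : List ℕ → Set
  Valid []       = ⊤
  Valid (a ∷ xs) = a < q × admissible xs a ≡ true × Valid xs

  compatible⇒≢ : ∀ a y → compatible a y ≡ true → a ≢ y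
  compatible⇒≢ a y ok a≡y = true≢false (trans (sym (≡ᵇ-true a≡y)) (not-true⁻¹ (∧-true₁ ok)))

  compatible⇒∤ : ∀ a y → compatible a y ≡ true → ¬ q ∣ a + y
  compatible⇒∤ a y ok q∣a+y = true≢false (trans (sym (dec-true (q ∣? (a + y)) q∣a+y)) (not-true⁻¹ (∧-true₂ ok)))

  compatible-intro : ∀ {a y} → a ≢ y → ¬ q ∣ a + y → compatible a y ≡ true
  compatible-intro {a} {y} a≢y q∤a+y = cong₂ (λ u v → not u ∧ not v) (≡ᵇ-false a≢y) (dec-false (q ∣? (a + y)) q∤a+y)

  compatible-zero : ∀ y → y < q → compatible 0 y ≡ not (y ≡ᵇ 0)
  compatible-zero zero    _   = refl
  compatible-zero (suc y) y<q rewrite dec-false (q ∣? suc y) (∤-positive (s≤s z≤n) y<q) = refl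

  compatibleWith-zero : ∀ xs → Valid xs → compatibleWith 0 xs ≡ not (hasZero xs)
  compatibleWith-zero []       _              = refl
  compatibleWith-zero (y ∷ ys) (y<q , _ , ys✓) =
    trans (cong₂ _∧_ (compatible-zero y y<q) (compatibleWith-zero ys ys✓)) (sym (not-∨ (y ≡ᵇ 0) (hasZero ys)))

  half≢0 : ∀ h → q ≡ h + h → h ≢ 0
  half≢0 h q≡2h refl = ℕₚ.<-irrefl (sym q≡2h) q>0

  half<q : ∀ h → q ≡ h + h → h < q
  half<q h q≡2h = subst (h <_) (sym q≡2h) (ℕₚ.m<m+n h (ℕₚ.n≢0⇒n>0 (half≢0 h q≡2h)))

  half+residue-∤ : ∀ h y → q ≡ h + h → y < q → h ≢ y → ¬ q ∣ h + y
  half+residue-∤ h y q≡2h y<q h≢y q∣h+y with ∣-sum-of-residues h y (half<q h q≡2h) y<q q∣h+y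
  ... | inj₁ (h≡0 , _) = half≢0 h q≡2h h≡0
  ... | inj₂ h+y≡q     = h≢y (sym (ℕₚ.+-cancelˡ-≡ h y h (trans h+y≡q q≡2h)))

  compatible-half : ∀ h y → q ≡ h + h → y < q → compatible h y ≡ not ((y + y) ≡ᵇ q)
  compatible-half h y q≡2h y<q with h ℕ.≟ y
  ... | yes refl rewrite ≡ᵇ-true {h} refl | ≡ᵇ-true (sym q≡2h) = refl
  ... | no h≢y rewrite ≡ᵇ-false h≢y | dec-false (q ∣? (h + y)) (half+residue-∤ h y q≡2h y<q h≢y)
                     | ≡ᵇ-false (λ 2y≡q → h≢y (sym (double-injective (trans 2y≡q q≡2h)))) = refl

  compatibleWith-half : ∀ h xs → q ≡ h + h → Valid xs → compatibleWith h xs ≡ not (hasHalf xs)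
  compatibleWith-half h []       _    _              = refl
  compatibleWith-half h (y ∷ ys) q≡2h (y<q , _ , ys✓) =
    trans (cong₂ _∧_ (compatible-half h y q≡2h y<q) (compatibleWith-half h ys q≡2h ys✓))
          (sym (not-∨ _ (hasHalf ys)))

  annihilates-zero : ∀ p → annihilates p 0 ≡ true
  annihilates-zero p = dec-true (q ∣? (s (suc p) * 0)) (subst (q ∣_) (sym (ℕₚ.*-zeroʳ (s (suc p)))) (q ∣0))

  admissible-zero : ∀ xs → Valid xs → admissible xs 0 ≡ (if length xs <ᵇ t then false else not (hasZero xs))
  admissible-zero xs xs✓ with length xs <ᵇ t
  ... | true rewrite annihilates-zero (length xs) = refl
  ... | false = compatibleWith-zero xs xs✓

  admissible-half : ∀ h xs → q ≡ h + h → Valid xs →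
    admissible xs h ≡ not ((length xs <ᵇ t) ∧ annihilates (length xs) h) ∧ not (hasHalf xs)
  admissible-half h xs q≡2h xs✓ = cong (not (killed (length xs) h) ∧_) (compatibleWith-half h xs q≡2h xs✓)

  killed-antitone : ∀ j p y → j ≤ p → killed p y ≡ true → killed j y ≡ true
  killed-antitone j p y j≤p killed-p =
    cong₂ _∧_ (<ᵇ-true j<t)
      (dec-true (q ∣? _) (∣-trans (does-true⁻¹ (q ∣? _) (∧-true₂ killed-p)) (*-monoˡ-∣ y (s-chain j p j≤p p<t))))
    where
    p<t : p < t
    p<t = <ᵇ-true⁻¹ p t (∧-true₁ killed-p)
    j<t : j < t
    j<t = ℕₚ.≤-<-trans j≤p p<t

  ValidAt : ℕ → List ℕ → Set
  ValidAt p []       = ⊤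
  ValidAt p (y ∷ ys) = y < q × killed p y ≡ false × compatibleWith y ys ≡ true × ValidAt p ys

  Valid⇒ValidAt : ∀ xs → Valid xs → ∀ p → length xs ≤ p → ValidAt p xs
  Valid⇒ValidAt []       _                   p _   = tt
  Valid⇒ValidAt (y ∷ ys) (y<q , y-ok , ys✓) p ys<p =
    y<q , ≢true⇒≡false survives , ∧-true₂ y-ok , Valid⇒ValidAt ys ys✓ p (ℕₚ.<⇒≤ ys<p)
    where
    survives : killed p y ≢ true
    survives killed-p = true≢false (trans (sym (killed-antitone (length ys) p y (ℕₚ.<⇒≤ ys<p) killed-p))
                                          (not-true⁻¹ (∧-true₁ y-ok)))

  genericCount : List ℕ → ℕ
  genericCount []       = 0
  genericCount (y ∷ ys) = 𝟙 (not (y ≡ᵇ 0) ∧ not ((y + y) ≡ᵇ q)) + genericCount ys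

  hasZero-absent : ∀ ys → compatibleWith 0 ys ≡ true → hasZero ys ≡ false
  hasZero-absent []          _  = refl
  hasZero-absent (zero ∷ ys) ()
  hasZero-absent (suc y ∷ ys) ok = hasZero-absent ys (∧-true₂ ok)

  hasHalf-absent : ∀ h ys → q ≡ h + h → compatibleWith h ys ≡ true → hasHalf ys ≡ false
  hasHalf-absent h []       _    _  = refl
  hasHalf-absent h (y ∷ ys) q≡2h ok
    rewrite ≡ᵇ-false {y + y} {q} (λ 2y≡q → compatible⇒≢ h y (∧-true₁ ok) (sym (double-injective (trans 2y≡q q≡2h))))
    = hasHalf-absent h ys q≡2h (∧-true₂ ok)

  length-decomposition : ∀ xs → Valid xs → genericCount xs + 𝟙 (hasZero xs) + 𝟙 (hasHalf xs) ≡ length xs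
  length-decomposition []       _                   = refl
  length-decomposition (y ∷ ys) (y<q , y-ok , ys✓) = begin
    𝟙 g + G + 𝟙 (z ∨ hasZero ys) + 𝟙 (h ∨ hasHalf ys)
      ≡⟨ cong₂ (λ u v → 𝟙 g + G + u + v) (𝟙-∨-disjoint z (hasZero ys) zero-fresh) (𝟙-∨-disjoint h (hasHalf ys) half-fresh) ⟩
    𝟙 g + G + (𝟙 z + 𝟙 (hasZero ys)) + (𝟙 h + 𝟙 (hasHalf ys))
      ≡⟨ regroup (𝟙 g) G (𝟙 z) (𝟙 (hasZero ys)) (𝟙 h) (𝟙 (hasHalf ys)) ⟩
    (𝟙 g + 𝟙 z + 𝟙 h) + (G + 𝟙 (hasZero ys) + 𝟙 (hasHalf ys))
      ≡⟨ cong₂ _+_ (𝟙-trichotomy z h zero⇒¬half) (length-decomposition ys ys✓) ⟩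
    suc (length ys) ∎
    where
    z = y ≡ᵇ 0
    h = (y + y) ≡ᵇ q
    g = not z ∧ not h
    G = genericCount ys
    zero-fresh : z ≡ true → hasZero ys ≡ false
    zero-fresh z≡true with ≡ᵇ-true⁻¹ y 0 z≡true
    ... | refl = hasZero-absent ys (∧-true₂ y-ok)
    half-fresh : h ≡ true → hasHalf ys ≡ false
    half-fresh h≡true = hasHalf-absent y ys (sym (≡ᵇ-true⁻¹ _ q h≡true)) (∧-true₂ y-ok)
    zero⇒¬half : z ≡ true → h ≡ false
    zero⇒¬half z≡true with ≡ᵇ-true⁻¹ y 0 z≡true
    ... | refl = ≡ᵇ-false (λ 0≡q → ℕₚ.<-irrefl 0≡q q>0)
    regroup : ∀ a b c d e f → a + b + (c + d) + (e + f) ≡ (a + c + e) + (b + d + f)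
    regroup = solve-∀

  generic : ℕ → ℕ → Bool
  generic p a = not (killed p a) ∧ (not (a ≡ᵇ 0) ∧ not ((a + a) ≡ᵇ q))

  generic⇒≢0 : ∀ p a → generic p a ≡ true → a ≢ 0
  generic⇒≢0 p a a-generic = ≡ᵇ-false⁻¹ a 0 (not-true⁻¹ (∧-true₁ (∧-true₂ {not (killed p a)} a-generic)))

  generic⇒≢half : ∀ p a → generic p a ≡ true → a + a ≢ q
  generic⇒≢half p a a-generic =
    ≡ᵇ-false⁻¹ (a + a) q (not-true⁻¹ (∧-true₂ {not (a ≡ᵇ 0)} (∧-true₂ {not (killed p a)} a-generic)))

  special-≢ : ∀ {a y} → (y ≡ 0 ⊎ y + y ≡ q) → a ≢ 0 → a + a ≢ q → a ≢ y
  special-≢ (inj₁ y≡0)  a≢0 _    refl = a≢0 y≡0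
  special-≢ (inj₂ 2y≡q) _   2a≢q refl = 2a≢q 2y≡q

  special-∤ : ∀ a y → a < q → y < q → (y ≡ 0 ⊎ y + y ≡ q) → a ≢ 0 → a + a ≢ q → ¬ q ∣ a + y
  special-∤ a y a<q y<q y-special a≢0 2a≢q q∣a+y with ∣-sum-of-residues a y a<q y<q q∣a+y
  special-∤ a y a<q y<q _           a≢0 _    _ | inj₁ (a≡0 , _) = a≢0 a≡0
  special-∤ a y a<q y<q (inj₁ refl) _   _    _ | inj₂ a+0≡q     = ℕₚ.<-irrefl (trans (sym (ℕₚ.+-identityʳ a)) a+0≡q) a<q
  special-∤ a y a<q y<q (inj₂ 2y≡q) _   2a≢q _ | inj₂ a+y≡q     =
    2a≢q (trans (cong (λ w → a + w) (ℕₚ.+-cancelʳ-≡ y a y (trans a+y≡q (sym 2y≡q)))) a+y≡q)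

  compatible-special : ∀ a y → a < q → y < q → (y ≡ 0 ⊎ y + y ≡ q) → a ≢ 0 → a + a ≢ q → compatible a y ≡ true
  compatible-special a y a<q y<q y-special a≢0 2a≢q =
    compatible-intro (special-≢ y-special a≢0 2a≢q) (special-∤ a y a<q y<q y-special a≢0 2a≢q)

  compatible-generic : ∀ a y → a < q → y < q → y ≢ 0 → compatible a y ≡ not (a ≡ᵇ y) ∧ not (a ≡ᵇ (q ∸ y))
  compatible-generic a y a<q y<q y≢0 = cong (λ w → not (a ≡ᵇ y) ∧ not w) multiple≡
    where
    multiple≡ : multiple (a + y) ≡ (a ≡ᵇ (q ∸ y))
    multiple≡ with a ℕ.≟ q ∸ y
    ... | yes refl = trans (dec-true (q ∣? _) (subst (q ∣_) (sym (ℕₚ.m∸n+n≡m (ℕₚ.<⇒≤ y<q))) (n∣n {q})))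
                           (sym (≡ᵇ-true {q ∸ y} refl))
    ... | no a≢q∸y = trans (dec-false (q ∣? _) q∤a+y) (sym (≡ᵇ-false a≢q∸y))
      where
      q∤a+y : ¬ q ∣ a + y
      q∤a+y q∣a+y with ∣-sum-of-residues a y a<q y<q q∣a+y
      ... | inj₁ (_ , y≡0) = y≢0 y≡0
      ... | inj₂ a+y≡q     = a≢q∸y (trans (sym (ℕₚ.m+n∸n≡m a y)) (cong (_∸ y) a+y≡q))

  killed-negate : ∀ p y → y < q → killed p y ≡ false → killed p (q ∸ y) ≡ false
  killed-negate p y y<q y-survives = ≢true⇒≡false λ killed-q∸y →
    true≢false (trans (sym (cong₂ _∧_ (∧-true₁ killed-q∸y) (dec-true (q ∣? _) (q∣sy killed-q∸y)))) y-survives)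
    where
    sum≡ : s (suc p) * (q ∸ y) + s (suc p) * y ≡ s (suc p) * q
    sum≡ = trans (sym (ℕₚ.*-distribˡ-+ (s (suc p)) (q ∸ y) y)) (cong (s (suc p) *_) (ℕₚ.m∸n+n≡m (ℕₚ.<⇒≤ y<q)))
    q∣sy : killed p (q ∸ y) ≡ true → q ∣ s (suc p) * y
    q∣sy killed-q∸y = ∣m+n∣m⇒∣n (subst (q ∣_) (sym sum≡) (n∣m*n (s (suc p)))) (does-true⁻¹ (q ∣? _) (∧-true₂ killed-q∸y))

  q∸y<q : ∀ y → y ≢ 0 → y < q → q ∸ y < q
  q∸y<q y y≢0 y<q = ℕₚ.∸-monoʳ-< {q} {y} {0} (ℕₚ.n≢0⇒n>0 y≢0) (ℕₚ.<⇒≤ y<q)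

  compatibleWith-negate : ∀ p y ys → y < q → y ≢ 0 → ValidAt p ys →
    compatibleWith y ys ≡ true → compatibleWith (q ∸ y) ys ≡ true
  compatibleWith-negate p y []       y<q y≢0 _                   _  = refl
  compatibleWith-negate p y (z ∷ zs) y<q y≢0 (z<q , _ , _ , zs✓) ok =
    cong₂ _∧_ (compatible-intro q∸y≢z q∤q∸y+z) (compatibleWith-negate p y zs y<q y≢0 zs✓ (∧-true₂ ok))
    where
    q∸y≢z : q ∸ y ≢ z
    q∸y≢z refl = compatible⇒∤ y (q ∸ y) (∧-true₁ ok) (subst (q ∣_) (sym (ℕₚ.m+[n∸m]≡n (ℕₚ.<⇒≤ y<q))) (n∣n {q}))
    q∤q∸y+z : ¬ q ∣ (q ∸ y) + z
    q∤q∸y+z q∣ with ∣-sum-of-residues (q ∸ y) z (q∸y<q y y≢0 y<q) z<q q∣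
    ... | inj₁ (q∸y≡0 , _) = ℕₚ.<-irrefl refl (ℕₚ.<-≤-trans y<q (ℕₚ.m∸n≡0⇒m≤n q∸y≡0))
    ... | inj₂ sum≡q = compatible⇒≢ y z (∧-true₁ ok)
                         (sym (ℕₚ.+-cancelˡ-≡ (q ∸ y) z y (trans sum≡q (sym (ℕₚ.m∸n+n≡m (ℕₚ.<⇒≤ y<q))))))

  generic-intro : ∀ p a → killed p a ≡ false → a ≢ 0 → a + a ≢ q → generic p a ≡ true
  generic-intro p a a-survives a≢0 2a≢q =
    cong₂ (λ u v → not u ∧ v) a-survives (cong₂ (λ u v → not u ∧ not v) (≡ᵇ-false a≢0) (≡ᵇ-false 2a≢q))

  special⇒non-generic : ∀ {y} → (y ≡ 0 ⊎ y + y ≡ q) → not (y ≡ᵇ 0) ∧ not ((y + y) ≡ᵇ q) ≡ false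
  special⇒non-generic (inj₁ refl) = refl
  special⇒non-generic {y} (inj₂ 2y≡q) rewrite ≡ᵇ-true 2y≡q = Boolₚ.∧-zeroʳ (not (y ≡ᵇ 0))

  special-step : ∀ p y ys → y < q → (y ≡ 0 ⊎ y + y ≡ q) →
    count q (λ a → generic p a ∧ compatibleWith a ys) + 2 * genericCount ys ≡ count q (generic p) →
    count q (λ a → generic p a ∧ compatibleWith a (y ∷ ys)) + 2 * genericCount (y ∷ ys) ≡ count q (generic p)
  special-step p y ys y<q y-special IH =
    trans (cong₂ (λ u v → u + 2 * (𝟙 v + genericCount ys)) (count-cong q unaffected) (special⇒non-generic y-special)) IH
    where
    unaffected : ∀ a → a < q → generic p a ∧ compatibleWith a (y ∷ ys) ≡ generic p a ∧ compatibleWith a ys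
    unaffected a a<q with generic p a in a-generic
    ... | false = refl
    ... | true  = cong (_∧ compatibleWith a ys)
                    (compatible-special a y a<q y<q y-special (generic⇒≢0 p a a-generic) (generic⇒≢half p a a-generic))

  generic-step : ∀ p y ys → y < q → killed p y ≡ false → compatibleWith y ys ≡ true → ValidAt p ys →
    y ≢ 0 → y + y ≢ q →
    count q (λ a → generic p a ∧ compatibleWith a ys) + 2 * genericCount ys ≡ count q (generic p) →
    count q (λ a → generic p a ∧ compatibleWith a (y ∷ ys)) + 2 * genericCount (y ∷ ys) ≡ count q (generic p)
  generic-step p y ys y<q y-survives y-ok ys✓ y≢0 2y≢q IH = begin
    X + 2 * (𝟙 (not (y ≡ᵇ 0) ∧ not ((y + y) ≡ᵇ q)) + genericCount ys)
      ≡⟨ cong (λ b → X + 2 * (𝟙 b + genericCount ys)) (cong₂ (λ u v → not u ∧ not v) (≡ᵇ-false y≢0) (≡ᵇ-false 2y≢q)) ⟩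
    X + 2 * (1 + genericCount ys)      ≡⟨ regroup X (genericCount ys) ⟩
    suc (suc X) + 2 * genericCount ys  ≡⟨ cong (_+ 2 * genericCount ys) count-P ⟨
    count q P + 2 * genericCount ys    ≡⟨ IH ⟩
    count q (generic p)                ∎
    where
    y′ = q ∸ y
    P : ℕ → Bool
    P a = generic p a ∧ compatibleWith a ys
    X = count q (λ a → generic p a ∧ (compatible a y ∧ compatibleWith a ys))
    y+y′≡q : y + y′ ≡ q
    y+y′≡q = ℕₚ.m+[n∸m]≡n (ℕₚ.<⇒≤ y<q)
    y′≢y : y′ ≢ y
    y′≢y y′≡y = 2y≢q (trans (cong (λ w → y + w) (sym y′≡y)) y+y′≡q)
    y′≢0 : y′ ≢ 0
    y′≢0 y′≡0 = ℕₚ.<-irrefl refl (ℕₚ.<-≤-trans y<q (ℕₚ.m∸n≡0⇒m≤n y′≡0))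
    2y′≢q : y′ + y′ ≢ q
    2y′≢q 2y′≡q = y′≢y (sym (ℕₚ.+-cancelʳ-≡ y′ y y′ (trans y+y′≡q (sym 2y′≡q))))
    P-y : P y ≡ true
    P-y = cong₂ _∧_ (generic-intro p y y-survives y≢0 2y≢q) y-ok
    P-y′ : P y′ ∧ not (y′ ≡ᵇ y) ≡ true
    P-y′ = cong₂ (λ u v → u ∧ not v)
             (cong₂ _∧_ (generic-intro p y′ (killed-negate p y y<q y-survives) y′≢0 2y′≢q)
                        (compatibleWith-negate p y ys y<q y≢0 ys✓ y-ok))
             (≡ᵇ-false y′≢y)
    rearrange : ∀ x u v z → x ∧ ((u ∧ v) ∧ z) ≡ ((x ∧ z) ∧ u) ∧ v
    rearrange false u v z     = refl
    rearrange true  u v true  = Boolₚ.∧-identityʳ (u ∧ v)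
    rearrange true  u v false = Boolₚ.∧-zeroʳ (u ∧ v)
    X≡ : X ≡ count q (λ a → (P a ∧ not (a ≡ᵇ y)) ∧ not (a ≡ᵇ y′))
    X≡ = count-cong q (λ a a<q → trans (cong (λ c → generic p a ∧ (c ∧ compatibleWith a ys))
                                               (compatible-generic a y a<q y<q y≢0))
                                      (rearrange (generic p a) _ _ (compatibleWith a ys)))
    count-P : count q P ≡ suc (suc X)
    count-P = trans (count-remove q P y y<q P-y)
                    (cong suc (trans (count-remove q _ y′ (q∸y<q y y≢0 y<q) P-y′) (cong suc (sym X≡))))
    regroup : ∀ x n → x + 2 * (1 + n) ≡ suc (suc x) + 2 * n
    regroup = solve-∀

  count-generic-compatible : ∀ p ys → ValidAt p ys →
    count q (λ a → generic p a ∧ compatibleWith a ys) + 2 * genericCount ys ≡ count q (generic p)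
  count-generic-compatible p [] _ =
    trans (ℕₚ.+-identityʳ _) (count-cong q (λ a _ → Boolₚ.∧-identityʳ (generic p a)))
  count-generic-compatible p (y ∷ ys) (y<q , y-survives , y-ok , ys✓) with y ℕ.≟ 0 | (y + y) ℕ.≟ q
  ... | yes y≡0 | _        = special-step p y ys y<q (inj₁ y≡0) (count-generic-compatible p ys ys✓)
  ... | no _    | yes 2y≡q = special-step p y ys y<q (inj₂ 2y≡q) (count-generic-compatible p ys ys✓)
  ... | no y≢0  | no 2y≢q  =
    generic-step p y ys y<q y-survives y-ok ys✓ y≢0 2y≢q (count-generic-compatible p ys ys✓)

  count-half : ∀ {e} → Parity e → (P : ℕ → Bool) (v : Bool) → (∀ h → q ≡ h + h → P h ≡ v) →
    count q (λ a → P a ∧ ((a + a) ≡ᵇ q)) ≡ 𝟙 (e ∧ v)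
  count-half (even h q≡2h) P v P-half =
    trans (count-atMostOne q _ h (half<q h q≡2h)
            (λ a _ ok → double-injective (trans (≡ᵇ-true⁻¹ _ q (∧-true₂ {P a} ok)) q≡2h)))
          (cong 𝟙 (trans (cong₂ _∧_ (P-half h q≡2h) (≡ᵇ-true (sym q≡2h))) (Boolₚ.∧-identityʳ v)))
  count-half (odd q-odd) P v P-half =
    count-none q _ (λ a _ → trans (cong (P a ∧_) (≡ᵇ-false (q-odd a))) (Boolₚ.∧-zeroʳ (P a)))

  module Choices (qEven : Bool) (parity : Parity qEven) (sEven : ℕ → Bool) (d : ℕ → ℕ)
                 (count-annihilates : ∀ p → p < t → count q (annihilates p) ≡ d (suc p))
                 (annihilates-half : ∀ h p → q ≡ h + h → p < t → annihilates p h ≡ sEven (suc p)) where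

    open Ways q t qEven sEven d using (halfAllowed; excluded; zeroFree; halfFree; genericFree; step)

    nonSpecial : ℕ → Bool
    nonSpecial a = not (a ≡ᵇ 0) ∧ not ((a + a) ≡ᵇ q)

    excludedCount : ℕ → ℕ
    excludedCount p = if p <ᵇ t then d (suc p) + 𝟙 (halfAllowed p) else 1 + 𝟙 qEven

    count-generic+excluded : ∀ p → count q (generic p) + excludedCount p ≡ q
    count-generic+excluded p with p <ᵇ t in p<ᵇt
    ... | false = begin
      count q nonSpecial + (1 + 𝟙 qEven)
        ≡⟨ regroup (count q nonSpecial) (𝟙 qEven) ⟩
      suc (𝟙 qEven + count q nonSpecial)
        ≡⟨ cong (λ c → suc (c + count q nonSpecial)) half-part ⟨
      suc (count q (λ a → not (a ≡ᵇ 0) ∧ ((a + a) ≡ᵇ q)) + count q nonSpecial)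
        ≡⟨ cong suc (count-split q (λ a → not (a ≡ᵇ 0)) (λ a → (a + a) ≡ᵇ q)) ⟨
      suc (count q (λ a → not (a ≡ᵇ 0)))
        ≡⟨ count-remove q (λ _ → true) 0 q>0 refl ⟨
      count q (λ _ → true)
        ≡⟨ count-all q _ (λ _ _ → refl) ⟩
      q ∎
      where
      half-part : count q (λ a → not (a ≡ᵇ 0) ∧ ((a + a) ≡ᵇ q)) ≡ 𝟙 qEven
      half-part = trans (count-half parity (λ a → not (a ≡ᵇ 0)) true (λ h q≡2h → cong not (≡ᵇ-false (half≢0 h q≡2h))))
                        (cong 𝟙 (Boolₚ.∧-identityʳ qEven))
      regroup : ∀ c e → c + (1 + e) ≡ suc (e + c)
      regroup = solve-∀
    ... | true = begin
      count q (λ a → survives a ∧ nonSpecial a) + (d (suc p) + 𝟙 (halfAllowed p))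
        ≡⟨ cong (_+ (d (suc p) + 𝟙 (halfAllowed p))) (count-cong q (λ a _ → sym (Boolₚ.∧-assoc (survives a) _ _))) ⟩
      count q (λ a → (survives a ∧ not (a ≡ᵇ 0)) ∧ not ((a + a) ≡ᵇ q)) + (d (suc p) + 𝟙 (halfAllowed p))
        ≡⟨ regroup _ (d (suc p)) (𝟙 (halfAllowed p)) ⟩
      d (suc p) + (𝟙 (halfAllowed p) + count q (λ a → (survives a ∧ not (a ≡ᵇ 0)) ∧ not ((a + a) ≡ᵇ q)))
        ≡⟨ cong₂ (λ u v → u + (v + count q (λ a → (survives a ∧ not (a ≡ᵇ 0)) ∧ not ((a + a) ≡ᵇ q))))
                 (count-annihilates p (<ᵇ-true⁻¹ p t p<ᵇt)) half-part ⟨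
      count q (annihilates p) + (count q (λ a → (survives a ∧ not (a ≡ᵇ 0)) ∧ ((a + a) ≡ᵇ q))
                                 + count q (λ a → (survives a ∧ not (a ≡ᵇ 0)) ∧ not ((a + a) ≡ᵇ q)))
        ≡⟨ cong (λ w → count q (annihilates p) + w)
                (count-split q (λ a → survives a ∧ not (a ≡ᵇ 0)) (λ a → (a + a) ≡ᵇ q)) ⟨
      count q (annihilates p) + count q (λ a → survives a ∧ not (a ≡ᵇ 0))
        ≡⟨ cong (λ w → count q (annihilates p) + w) (trans (count-split q survives (λ a → a ≡ᵇ 0))
                                                     (cong (_+ count q (λ a → survives a ∧ not (a ≡ᵇ 0))) zero-part)) ⟨
      count q (annihilates p) + count q survives
        ≡⟨ count-split q (λ _ → true) (annihilates p) ⟨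
      count q (λ _ → true)
        ≡⟨ count-all q _ (λ _ _ → refl) ⟩
      q ∎
      where
      survives : ℕ → Bool
      survives a = not (annihilates p a)
      zero-part : count q (λ a → survives a ∧ (a ≡ᵇ 0)) ≡ 0
      zero-part = trans (count-atMostOne q _ 0 q>0 (λ a _ ok → ≡ᵇ-true⁻¹ a 0 (∧-true₂ {survives a} ok)))
                        (cong (λ b → 𝟙 (not b ∧ true)) (annihilates-zero p))
      half-part : count q (λ a → (survives a ∧ not (a ≡ᵇ 0)) ∧ ((a + a) ≡ᵇ q)) ≡ 𝟙 (halfAllowed p)
      half-part = count-half parity (λ a → survives a ∧ not (a ≡ᵇ 0)) (not (sEven (suc p)))
        (λ h q≡2h → trans (cong₂ (λ u v → not u ∧ not v) (annihilates-half h p q≡2h (<ᵇ-true⁻¹ p t p<ᵇt))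
                                                         (≡ᵇ-false (half≢0 h q≡2h)))
                          (Boolₚ.∧-identityʳ _))
      regroup : ∀ c x y → c + (x + y) ≡ x + (y + c)
      regroup = solve-∀

    excludedCount≡excluded : ∀ p → + excludedCount p ≡ excluded (p <ᵇ t) p
    excludedCount≡excluded p with p <ᵇ t
    ... | true  = ℤₚ.pos-+ (d (suc p)) (𝟙 (halfAllowed p))
    ... | false = ℤₚ.pos-+ 1 (𝟙 qEven)

    count-admissible-zero : ∀ xs → Valid xs →
      count q (λ a → admissible xs a ∧ (a ≡ᵇ 0)) ≡ 𝟙 (zeroFree (length xs <ᵇ t) (hasZero xs))
    count-admissible-zero xs xs✓ =
      trans (count-atMostOne q _ 0 q>0 (λ a _ ok → ≡ᵇ-true⁻¹ a 0 (∧-true₂ {admissible xs a} ok)))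
            (cong 𝟙 (trans (Boolₚ.∧-identityʳ _) (trans (admissible-zero xs xs✓) (if≡zeroFree (length xs <ᵇ t)))))
      where
      if≡zeroFree : ∀ b → (if b then false else not (hasZero xs)) ≡ zeroFree b (hasZero xs)
      if≡zeroFree true  = refl
      if≡zeroFree false = refl

    count-admissible-half : ∀ xs → Valid xs →
      count q (λ a → admissible xs a ∧ ((a + a) ≡ᵇ q)) ≡ 𝟙 (halfFree (length xs <ᵇ t) (length xs) (hasHalf xs))
    count-admissible-half xs xs✓ = by-position (length xs <ᵇ t) refl
      where
      p = length xs
      by-position : ∀ b → (p <ᵇ t) ≡ b → count q (λ a → admissible xs a ∧ ((a + a) ≡ᵇ q)) ≡ 𝟙 (halfFree b p (hasHalf xs))
      by-position true p<ᵇt =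
        trans (count-half parity (admissible xs) (not (sEven (suc p)) ∧ not (hasHalf xs))
                (λ h q≡2h → trans (admissible-half h xs q≡2h xs✓)
                              (cong (λ b → not b ∧ not (hasHalf xs))
                                (trans (cong (_∧ annihilates p h) p<ᵇt) (annihilates-half h p q≡2h (<ᵇ-true⁻¹ p t p<ᵇt))))))
              (cong 𝟙 (sym (Boolₚ.∧-assoc qEven _ _)))
      by-position false p≮ᵇt =
        count-half parity (admissible xs) (not (hasHalf xs))
          (λ h q≡2h → trans (admissible-half h xs q≡2h xs✓)
                        (cong (λ b → not (b ∧ annihilates p h) ∧ not (hasHalf xs)) p≮ᵇt))

    count-admissible-generic : ∀ xs → Valid xs →
      + count q (λ a → admissible xs a ∧ nonSpecial a) ≡ genericFree (length xs <ᵇ t) (length xs) (hasZero xs) (hasHalf xs)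
    count-admissible-generic xs xs✓ =
      trans (isolate {N = + genericCount xs} {E = + excludedCount p} {Z = + 𝟙 (hasZero xs)} {H = + 𝟙 (hasHalf xs)}
                     compatible-part total-part length-part)
            (cong (λ e → + q ℤ.- e ℤ.- + 2 ℤ.* (+ p ℤ.- + 𝟙 (hasZero xs) ℤ.- + 𝟙 (hasHalf xs)))
                  (excludedCount≡excluded p))
      where
      p = length xs
      rotate : ∀ a → admissible xs a ∧ nonSpecial a ≡ generic p a ∧ compatibleWith a xs
      rotate a = trans (Boolₚ.∧-assoc (not (killed p a)) _ _)
                       (trans (cong (not (killed p a) ∧_) (Boolₚ.∧-comm (compatibleWith a xs) (nonSpecial a)))
                              (sym (Boolₚ.∧-assoc (not (killed p a)) _ _)))
      compatible-part : + count q (λ a → admissible xs a ∧ nonSpecial a) ℤ.+ + 2 ℤ.* + genericCount xs ≡ + count q (generic p)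
      compatible-part = trans (cong₂ ℤ._+_ (cong +_ (count-cong q (λ a _ → rotate a))) (sym (ℤₚ.pos-* 2 (genericCount xs))))
                              (trans (sym (ℤₚ.pos-+ (count q (λ a → generic p a ∧ compatibleWith a xs))
                                                    (2 * genericCount xs)))
                                     (cong +_ (count-generic-compatible p xs (Valid⇒ValidAt xs xs✓ p ℕₚ.≤-refl))))
      total-part : + count q (generic p) ℤ.+ + excludedCount p ≡ + q
      total-part = trans (sym (ℤₚ.pos-+ (count q (generic p)) (excludedCount p))) (cong +_ (count-generic+excluded p))
      length-part : + genericCount xs ℤ.+ + 𝟙 (hasZero xs) ℤ.+ + 𝟙 (hasHalf xs) ≡ + p
      length-part = trans (cong (ℤ._+ + 𝟙 (hasHalf xs)) (sym (ℤₚ.pos-+ (genericCount xs) (𝟙 (hasZero xs)))))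
                          (trans (sym (ℤₚ.pos-+ (genericCount xs + 𝟙 (hasZero xs)) (𝟙 (hasHalf xs))))
                                 (cong +_ (length-decomposition xs xs✓)))

    sum-admissible : ∀ xs → Valid xs → (W : Bool → Bool → ℤ) →
      sum q (λ a → if admissible xs a then W ((a ≡ᵇ 0) ∨ hasZero xs) (((a + a) ≡ᵇ q) ∨ hasHalf xs) else + 0)
        ≡ step (length xs <ᵇ t) (length xs) (hasZero xs) (hasHalf xs) W
    sum-admissible xs xs✓ W = begin
      sum q (λ a → if admissible xs a then W ((a ≡ᵇ 0) ∨ z) (((a + a) ≡ᵇ q) ∨ h) else + 0)
        ≡⟨ sum-by-kind q (admissible xs) (λ a → a ≡ᵇ 0) (λ a → (a + a) ≡ᵇ q) z h W zero⇒¬half ⟩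
      + count q (λ a → admissible xs a ∧ nonSpecial a) ℤ.* W z h
        ℤ.+ + count q (λ a → admissible xs a ∧ (a ≡ᵇ 0)) ℤ.* W true h
        ℤ.+ + count q (λ a → admissible xs a ∧ ((a + a) ≡ᵇ q)) ℤ.* W z true
        ≡⟨ cong₂ ℤ._+_ (cong₂ ℤ._+_ (cong (ℤ._* W z h) (count-admissible-generic xs xs✓))
                                      (cong (λ c → + c ℤ.* W true h) (count-admissible-zero xs xs✓)))
                         (cong (λ c → + c ℤ.* W z true) (count-admissible-half xs xs✓)) ⟩
      genericFree b p z h ℤ.* W z h ℤ.+ + 𝟙 (zeroFree b z) ℤ.* W true h ℤ.+ + 𝟙 (halfFree b p h) ℤ.* W z true
        ≡⟨ cong₂ (λ u v → genericFree b p z h ℤ.* W z h ℤ.+ u ℤ.+ v)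
                 (if-indicator (zeroFree b z) (W true h)) (if-indicator (halfFree b p h) (W z true)) ⟨
      step b p z h W ∎
      where
      p = length xs
      b = p <ᵇ t
      z = hasZero xs
      h = hasHalf xs
      zero⇒¬half : ∀ a → (a ≡ᵇ 0) ≡ true → ((a + a) ≡ᵇ q) ≡ false
      zero⇒¬half a a≡ᵇ0 with ≡ᵇ-true⁻¹ a 0 a≡ᵇ0
      ... | refl = ≡ᵇ-false (λ 0≡q → ℕₚ.<-irrefl 0≡q q>0)

module Entries where

  open import Data.Fin as Fin using (Fin; toℕ)
  open import Data.Integer using (ℤ; +_; _+_; _-_; _*_; -_)
  import Data.Integer.Properties as ℤₚ
  open import Data.Integer.Tactic.RingSolver using (solve-∀)
  open import Algebra.Properties.CommutativeMonoid.Sum ℤₚ.+-0-commutativeMonoid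
    using (sum; sum-cong-≗; sum-replicate-zero; ∑-distrib-+)
  open import Data.List using (foldr; tabulate)
  open import Relation.Nullary using (yes; no)
  open import Relation.Binary.PropositionalEquality

  foldr-tabulate : ∀ {A : Set} n (g : Fin n → A) (f : A → ℤ) →
    foldr (λ a acc → f a + acc) (+ 0) (tabulate g) ≡ sum (λ i → f (g i))
  foldr-tabulate zero    g f = refl
  foldr-tabulate (suc n) g f = cong (λ w → f (g Fin.zero) + w) (foldr-tabulate n (λ i → g (Fin.suc i)) f)

  sum-toℕ : ∀ n (f : ℕ → ℤ) → sum {n} (λ i → f (toℕ i)) ≡ Count.sum n f
  sum-toℕ zero    f = refl
  sum-toℕ (suc n) f = trans (cong (λ w → f 0 + w) (sum-toℕ n (λ a → f (suc a)))) (sym (Count.sum-suc n f))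

  entry≡sum : ∀ {m q} (x : Fin m → Fin q) c → entry x c ≡ sum (λ i → + toℕ (x i) * c i)
  entry≡sum {m} x c = foldr-tabulate m (λ i → i) (λ i → + toℕ (x i) * c i)

  unitVec-suc : ∀ {m} (i l : Fin m) → unitVec (Fin.suc i) (Fin.suc l) ≡ unitVec i l
  unitVec-suc i l with i Fin.≟ l
  ... | yes _ = refl
  ... | no  _ = refl

  sum-unitVec : ∀ m (g : Fin m → ℤ) (i : Fin m) → sum (λ l → g l * unitVec i l) ≡ g i
  sum-unitVec (suc m) g Fin.zero =
    trans (cong₂ _+_ (ℤₚ.*-identityʳ (g Fin.zero))
                     (trans (sum-cong-≗ (λ l → ℤₚ.*-zeroʳ (g (Fin.suc l)))) (sum-replicate-zero m)))
          (ℤₚ.+-identityʳ (g Fin.zero))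
  sum-unitVec (suc m) g (Fin.suc i) =
    trans (cong₂ _+_ (ℤₚ.*-zeroʳ (g Fin.zero))
                     (trans (sum-cong-≗ (λ l → cong (g (Fin.suc l) *_) (unitVec-suc i l)))
                            (sum-unitVec m (λ l → g (Fin.suc l)) i)))
          (ℤₚ.+-identityˡ (g (Fin.suc i)))

  entry-scaled : ∀ {m q} (x : Fin m → Fin q) (i : Fin m) v → entry x (λ j → v * unitVec i j) ≡ v * + toℕ (x i)
  entry-scaled {m} x i v =
    trans (entry≡sum x _) (trans (sum-cong-≗ (λ l → reassoc (+ toℕ (x l)) v (unitVec i l)))
                                 (sum-unitVec m (λ l → v * + toℕ (x l)) i))
    where
    reassoc : ∀ a v u → a * (v * u) ≡ v * a * u
    reassoc = solve-∀

  entry-difference : ∀ {m q} (x : Fin m → Fin q) (i j : Fin m) →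
    entry x (λ l → unitVec i l - unitVec j l) ≡ + toℕ (x i) - + toℕ (x j)
  entry-difference {m} x i j =
    trans (entry≡sum x _)
      (trans (sum-cong-≗ (λ l → distrib (+ toℕ (x l)) (unitVec i l) (unitVec j l)))
        (trans (∑-distrib-+ (λ l → + toℕ (x l) * unitVec i l) (λ l → - + toℕ (x l) * unitVec j l))
               (cong₂ _+_ (sum-unitVec m (λ l → + toℕ (x l)) i) (sum-unitVec m (λ l → - + toℕ (x l)) j))))
    where
    distrib : ∀ a u v → a * (u - v) ≡ a * u + - a * v
    distrib = solve-∀

  entry-sum : ∀ {m q} (x : Fin m → Fin q) (i j : Fin m) →
    entry x (λ l → unitVec i l + unitVec j l) ≡ + toℕ (x i) + + toℕ (x j)
  entry-sum {m} x i j =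
    trans (entry≡sum x _)
      (trans (sum-cong-≗ (λ l → ℤₚ.*-distribˡ-+ (+ toℕ (x l)) (unitVec i l) (unitVec j l)))
        (trans (∑-distrib-+ (λ l → + toℕ (x l) * unitVec i l) (λ l → + toℕ (x l) * unitVec j l))
               (cong₂ _+_ (sum-unitVec m (λ l → + toℕ (x l)) i) (sum-unitVec m (λ l → + toℕ (x l)) j))))

module Lists where

  open import Data.Fin using (Fin)
  open import Data.Bool using (true; false; if_then_else_)
  open import Data.List using (List; []; concatMap; allFin)
  open import Data.List.Relation.Unary.All using (All; [])
  import Data.List.Relation.Unary.All.Properties as Allₚ
  open import Relation.Binary.PropositionalEquality using (_≡_; refl)

  All-concatMap-allFin⁻ : ∀ {B : Set} {P : B → Set} {m} (f : Fin m → List B) →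
    All P (concatMap f (allFin m)) → ∀ i → All P (f i)
  All-concatMap-allFin⁻ f all = Allₚ.tabulate⁻ (Allₚ.map⁻ (Allₚ.concat⁻ all))

  All-concatMap-allFin⁺ : ∀ {B : Set} {P : B → Set} {m} (f : Fin m → List B) →
    (∀ i → All P (f i)) → All P (concatMap f (allFin m))
  All-concatMap-allFin⁺ f all = Allₚ.concat⁺ (Allₚ.map⁺ (Allₚ.tabulate⁺ all))

  All-if⁻ : ∀ {B : Set} {P : B → Set} b (cs : List B) → All P (if b then cs else []) → b ≡ true → All P cs
  All-if⁻ true cs all refl = all

  All-if⁺ : ∀ {B : Set} {P : B → Set} b (cs : List B) → (b ≡ true → All P cs) → All P (if b then cs else [])
  All-if⁺ true  cs all = all refl
  All-if⁺ false cs _   = []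

module Reduction (q : ℕ) (q>0 : 0 < q) (t : ℕ) (s : ℕ → ℕ)
                 (s-chain : ∀ j p → j ≤ p → p < t → s (suc p) ∣ s (suc j)) where

  open import Data.Nat using (_+_; _*_; _≡ᵇ_; _<ᵇ_; z≤n; s≤s)
  import Data.Nat.Properties as ℕₚ
  open import Data.Nat.Divisibility using (_∣?_; _∣0)
  open import Data.Integer as ℤ using (ℤ; +_; ∣_∣)
  import Data.Integer.Properties as ℤₚ
  open import Data.Fin as Fin using (Fin; toℕ)
  import Data.Fin.Properties as Finₚ
  open import Data.Bool using (true; false; if_then_else_; _∧_; _∨_; not; T)
  open import Data.List using (List; []; _∷_; length; map; concatMap; allFin; filter; foldr; _++_)
  import Data.List.Properties as Listₚ
  open import Data.List.Relation.Unary.All as All using (All; []; _∷_)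
  import Data.List.Relation.Unary.All.Properties as Allₚ
  open import Data.Empty using (⊥-elim)
  open import Data.Unit using (tt)
  open import Data.Product using (_×_; _,_; proj₁; proj₂)
  open import Relation.Nullary.Decidable using (dec-true; dec-false; T?)
  open import Relation.Binary.PropositionalEquality
  open import Relation.Binary.Definitions using (tri<; tri≈; tri>)
  open Booleans
  open Residues q q>0 t s s-chain
  import Algebra.Properties.CommutativeMonoid.Sum

  ∣difference∣ : ∀ a b → a < b → ∣ + a ℤ.- + b ∣ ≡ b ∸ a
  ∣difference∣ a b a<b = trans (cong ∣_∣ (ℤₚ.[+m]-[+n]≡m⊖n a b)) (ℤₚ.∣⊖∣-< a<b)

  ∣difference∣-residues : ∀ a b → a < q → b < q → q ∣ ∣ + a ℤ.- + b ∣ → a ≡ b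
  ∣difference∣-residues a b a<q b<q q∣ with ℕₚ.<-cmp a b
  ... | tri≈ _ a≡b _ = a≡b
  ... | tri< a<b _ _ = ⊥-elim (∤-positive (ℕₚ.m<n⇒0<n∸m a<b) (ℕₚ.≤-<-trans (ℕₚ.m∸n≤m b a) b<q)
                                (subst (q ∣_) (∣difference∣ a b a<b) q∣))
  ... | tri> _ _ b<a = ⊥-elim (∤-positive (ℕₚ.m<n⇒0<n∸m b<a) (ℕₚ.≤-<-trans (ℕₚ.m∸n≤m a b) a<q)
                                (subst (q ∣_) (trans (ℤₚ.∣i-j∣≡∣j-i∣ (+ a) (+ b)) (∣difference∣ b a b<a)) q∣))

  ∣difference∣-self : ∀ a → q ∣ ∣ + a ℤ.- + a ∣
  ∣difference∣-self a = subst (λ w → q ∣ ∣ w ∣) (sym (ℤₚ.+-inverseʳ (+ a))) (q ∣0)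

  killed-intro : ∀ p a → ((p <ᵇ t) ≡ true → ¬ q ∣ s (suc p) * a) → killed p a ≡ false
  killed-intro p a survives with p <ᵇ t
  ... | false = refl
  ... | true  = dec-false (q ∣? _) (survives refl)

  killed-elim : ∀ p a → killed p a ≡ false → (p <ᵇ t) ≡ true → ¬ q ∣ s (suc p) * a
  killed-elim p a survives p<ᵇt q∣ = true≢false (trans (sym (cong₂ _∧_ p<ᵇt (dec-true (q ∣? _) q∣))) survives)

  Extends : List ℕ → (m : ℕ) → (Fin m → Fin q) → Set
  Extends xs m f = (∀ i → killed (length xs + toℕ i) (toℕ (f i)) ≡ false)
                 × (∀ i → compatibleWith (toℕ (f i)) xs ≡ true)
                 × (∀ i j → toℕ j < toℕ i → compatible (toℕ (f i)) (toℕ (f j)) ≡ true)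

  extendsᵇ : List ℕ → (m : ℕ) → (Fin m → Fin q) → Bool
  extendsᵇ xs zero    f = true
  extendsᵇ xs (suc m) f = admissible xs (toℕ (f Fin.zero)) ∧ extendsᵇ (toℕ (f Fin.zero) ∷ xs) m (λ i → f (Fin.suc i))

  extendsᵇ⇒Extends : ∀ xs m f → extendsᵇ xs m f ≡ true → Extends xs m f
  extendsᵇ⇒Extends xs zero    f _  = (λ ()) , (λ ()) , (λ ())
  extendsᵇ⇒Extends xs (suc m) f ok = survives , compatible-prefix , compatible-pairs
    where
    x₀ = toℕ (f Fin.zero)
    x₀-ok : admissible xs x₀ ≡ true
    x₀-ok = ∧-true₁ ok
    rest = extendsᵇ⇒Extends (x₀ ∷ xs) m (λ i → f (Fin.suc i)) (∧-true₂ {admissible xs x₀} ok)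
    survives : ∀ i → killed (length xs + toℕ i) (toℕ (f i)) ≡ false
    survives Fin.zero    =
      subst (λ p → killed p x₀ ≡ false) (sym (ℕₚ.+-identityʳ (length xs))) (not-true⁻¹ (∧-true₁ x₀-ok))
    survives (Fin.suc i) =
      subst (λ p → killed p (toℕ (f (Fin.suc i))) ≡ false) (sym (ℕₚ.+-suc (length xs) (toℕ i))) (proj₁ rest i)
    compatible-prefix : ∀ i → compatibleWith (toℕ (f i)) xs ≡ true
    compatible-prefix Fin.zero    = ∧-true₂ {not (killed (length xs) x₀)} x₀-ok
    compatible-prefix (Fin.suc i) = ∧-true₂ {compatible (toℕ (f (Fin.suc i))) x₀} (proj₁ (proj₂ rest) i)
    compatible-pairs : ∀ i j → toℕ j < toℕ i → compatible (toℕ (f i)) (toℕ (f j)) ≡ true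
    compatible-pairs (Fin.suc i) Fin.zero    _         = ∧-true₁ (proj₁ (proj₂ rest) i)
    compatible-pairs (Fin.suc i) (Fin.suc j) (s≤s j<i) = proj₂ (proj₂ rest) i j j<i

  Extends⇒extendsᵇ : ∀ xs m f → Extends xs m f → extendsᵇ xs m f ≡ true
  Extends⇒extendsᵇ xs zero    f _ = refl
  Extends⇒extendsᵇ xs (suc m) f (survives , compatible-prefix , compatible-pairs) = cong₂ _∧_ x₀-ok rest
    where
    x₀ = toℕ (f Fin.zero)
    x₀-ok : admissible xs x₀ ≡ true
    x₀-ok = cong₂ (λ u v → not u ∧ v)
              (subst (λ p → killed p x₀ ≡ false) (ℕₚ.+-identityʳ (length xs)) (survives Fin.zero)) (compatible-prefix Fin.zero)
    rest : extendsᵇ (x₀ ∷ xs) m (λ i → f (Fin.suc i)) ≡ true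
    rest = Extends⇒extendsᵇ (x₀ ∷ xs) m (λ i → f (Fin.suc i))
      ( (λ i → subst (λ p → killed p (toℕ (f (Fin.suc i))) ≡ false) (ℕₚ.+-suc (length xs) (toℕ i))
                     (survives (Fin.suc i)))
      , (λ i → cong₂ _∧_ (compatible-pairs (Fin.suc i) Fin.zero (s≤s z≤n)) (compatible-prefix (Fin.suc i)))
      , (λ i j j<i → compatible-pairs (Fin.suc i) (Fin.suc j) (s≤s j<i)) )

  NonzeroEntry : ∀ {m} → (Fin m → Fin q) → Column m → Set
  NonzeroEntry x c = ¬ (q ∣ ∣ entry x c ∣)

  ∣entry-scaled∣ : ∀ {m} (x : Fin m → Fin q) i →
    ∣ entry x (λ j → + s (suc (toℕ i)) ℤ.* unitVec i j) ∣ ≡ s (suc (toℕ i)) * toℕ (x i)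
  ∣entry-scaled∣ x i =
    cong ∣_∣ (trans (Entries.entry-scaled x i (+ s (suc (toℕ i)))) (sym (ℤₚ.pos-* (s (suc (toℕ i))) (toℕ (x i)))))

  ∣entry-sum∣ : ∀ {m} (x : Fin m → Fin q) i j → ∣ entry x (λ l → unitVec i l ℤ.+ unitVec j l) ∣ ≡ toℕ (x i) + toℕ (x j)
  ∣entry-sum∣ x i j = cong ∣_∣ (trans (Entries.entry-sum x i j) (sym (ℤₚ.pos-+ (toℕ (x i)) (toℕ (x j)))))

  diagonalColumns : (m : ℕ) → List (Column m)
  diagonalColumns m =
    concatMap (λ i → if toℕ i <ᵇ t then (λ j → (+ s (suc (toℕ i))) ℤ.* unitVec i j) ∷ [] else []) (allFin m)

  D⇒Extends : ∀ m (x : Fin m → Fin q) → All (NonzeroEntry x) (D m t s) → Extends [] m x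
  D⇒Extends m x nonzero = survives , (λ _ → refl) , compatible-pairs
    where
    open Lists
    parts = Allₚ.++⁻ (diagonalColumns m) nonzero
    survives : ∀ i → killed (toℕ i) (toℕ (x i)) ≡ false
    survives i = killed-intro (toℕ i) (toℕ (x i)) λ i<ᵇt q∣ →
      All.head (All-if⁻ (toℕ i <ᵇ t) _ (All-concatMap-allFin⁻ _ (proj₁ parts) i) i<ᵇt)
               (subst (q ∣_) (sym (∣entry-scaled∣ x i)) q∣)
    compatible-pairs : ∀ i j → toℕ j < toℕ i → compatible (toℕ (x i)) (toℕ (x j)) ≡ true
    compatible-pairs i j j<i
      with All-if⁻ (toℕ j <ᵇ toℕ i) _
                   (All-concatMap-allFin⁻ _ (All-concatMap-allFin⁻ _ (proj₂ parts) j) i) (<ᵇ-true j<i)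
    ... | difference≢0 ∷ sum≢0 ∷ [] = compatible-intro
      (λ xi≡xj → difference≢0 (subst (q ∣_) (cong ∣_∣ (sym (Entries.entry-difference x j i)))
                                 (subst (λ w → q ∣ ∣ + w ℤ.- + toℕ (x i) ∣) xi≡xj (∣difference∣-self (toℕ (x i))))))
      (λ q∣ → sum≢0 (subst (q ∣_) (sym (∣entry-sum∣ x j i)) (subst (q ∣_) (ℕₚ.+-comm (toℕ (x i)) (toℕ (x j))) q∣)))

  Extends⇒D : ∀ m (x : Fin m → Fin q) → Extends [] m x → All (NonzeroEntry x) (D m t s)
  Extends⇒D m x (survives , _ , compatible-pairs) =
    Allₚ.++⁺ (All-concatMap-allFin⁺ _ diagonal) (All-concatMap-allFin⁺ _ (λ i → All-concatMap-allFin⁺ _ (offDiagonal i)))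
    where
    open Lists
    diagonal : ∀ i → All (NonzeroEntry x) (if toℕ i <ᵇ t then (λ j → (+ s (suc (toℕ i))) ℤ.* unitVec i j) ∷ [] else [])
    diagonal i = All-if⁺ (toℕ i <ᵇ t) _ λ i<ᵇt →
      (λ q∣ → killed-elim (toℕ i) (toℕ (x i)) (survives i) i<ᵇt (subst (q ∣_) (∣entry-scaled∣ x i) q∣)) ∷ []
    offDiagonal : ∀ i j → All (NonzeroEntry x)
      (if toℕ i <ᵇ toℕ j then (λ l → unitVec i l ℤ.- unitVec j l) ∷ (λ l → unitVec i l ℤ.+ unitVec j l) ∷ [] else [])
    offDiagonal i j = All-if⁺ (toℕ i <ᵇ toℕ j) _ λ i<ᵇj →
      let xj-ok = compatible-pairs j i (<ᵇ-true⁻¹ _ _ i<ᵇj) in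
      (λ q∣ → compatible⇒≢ (toℕ (x j)) (toℕ (x i)) xj-ok
                (sym (∣difference∣-residues (toℕ (x i)) (toℕ (x j)) (Finₚ.toℕ<n (x i)) (Finₚ.toℕ<n (x j))
                       (subst (q ∣_) (cong ∣_∣ (Entries.entry-difference x i j)) q∣))))
      ∷ (λ q∣ → compatible⇒∤ (toℕ (x j)) (toℕ (x i)) xj-ok
                  (subst (q ∣_) (ℕₚ.+-comm (toℕ (x i)) (toℕ (x j))) (subst (q ∣_) (∣entry-sum∣ x i j) q∣)))
      ∷ []

  countFilter : ∀ {A : Set} → (A → Bool) → List A → ℕ
  countFilter b V = length (filter (λ v → T? (b v)) V)

  countFilter-map : ∀ {A B : Set} (b : B → Bool) (h : A → B) V → countFilter b (map h V) ≡ countFilter (λ v → b (h v)) V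
  countFilter-map b h []       = refl
  countFilter-map b h (v ∷ V) with b (h v)
  ... | true  = cong suc (countFilter-map b h V)
  ... | false = countFilter-map b h V

  countFilter-guard : ∀ {A : Set} k (c : A → Bool) V → + countFilter (λ v → k ∧ c v) V ≡ (if k then + countFilter c V else + 0)
  countFilter-guard true  c V = refl
  countFilter-guard false c []      = refl
  countFilter-guard false c (v ∷ V) = countFilter-guard false c V

  countFilter-concatMap : ∀ {A B : Set} (b : B → Bool) (g : A → List B) L →
    + countFilter b (concatMap g L) ≡ foldr (λ a acc → + countFilter b (g a) ℤ.+ acc) (+ 0) L
  countFilter-concatMap b g []      = refl
  countFilter-concatMap b g (a ∷ L) = begin
    + length (filter _ (g a ++ concatMap g L))
      ≡⟨ cong (λ l → + length l) (Listₚ.filter-++ (λ v → T? (b v)) (g a) (concatMap g L)) ⟩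
    + length (filter _ (g a) ++ filter _ (concatMap g L))
      ≡⟨ cong +_ (Listₚ.length-++ (filter (λ v → T? (b v)) (g a))) ⟩
    + (countFilter b (g a) + countFilter b (concatMap g L))
      ≡⟨ ℤₚ.pos-+ (countFilter b (g a)) _ ⟩
    + countFilter b (g a) ℤ.+ + countFilter b (concatMap g L)
      ≡⟨ cong (λ w → + countFilter b (g a) ℤ.+ w) (countFilter-concatMap b g L) ⟩
    + countFilter b (g a) ℤ.+ foldr (λ a acc → + countFilter b (g a) ℤ.+ acc) (+ 0) L ∎
    where open ≡-Reasoning

  count-allVecs-suc : ∀ xs m → + countFilter (extendsᵇ xs (suc m)) (allVecs (suc m) q)
    ≡ Count.sum q (λ a → if admissible xs a then + countFilter (extendsᵇ (a ∷ xs) m) (allVecs m q) else + 0)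
  count-allVecs-suc xs m =
    trans (countFilter-concatMap (extendsᵇ xs (suc m)) _ (allFin q))
      (trans (Entries.foldr-tabulate q (λ a → a) _)
        (trans (FinSum.sum-cong-≗ (λ a → trans (cong +_ (countFilter-map (extendsᵇ xs (suc m)) _ (allVecs m q)))
                                               (countFilter-guard (admissible xs (toℕ a)) _ (allVecs m q))))
               (Entries.sum-toℕ q _)))
    where
    module FinSum = Algebra.Properties.CommutativeMonoid.Sum ℤₚ.+-0-commutativeMonoid

  module Counting (qEven : Bool) (parity : Parity qEven) (sEven : ℕ → Bool) (d : ℕ → ℕ)
                  (count-annihilates : ∀ p → p < t → Count.count q (annihilates p) ≡ d (suc p))
                  (annihilates-half : ∀ h p → q ≡ h + h → p < t → annihilates p h ≡ sEven (suc p)) where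

    open Choices qEven parity sEven d count-annihilates annihilates-half using (sum-admissible)
    open Ways q t qEven sEven d using (ways)

    count-extensions : ∀ m xs → Valid xs →
      + countFilter (extendsᵇ xs m) (allVecs m q) ≡ ways (length xs) m (hasZero xs) (hasHalf xs)
    count-extensions zero    xs _   = refl
    count-extensions (suc m) xs xs✓ =
      trans (count-allVecs-suc xs m)
            (trans (Count.sum-cong q extend) (sum-admissible xs xs✓ (ways (suc (length xs)) m)))
      where
      extend : ∀ a → a < q →
        (if admissible xs a then + countFilter (extendsᵇ (a ∷ xs) m) (allVecs m q) else + 0)
        ≡ (if admissible xs a then ways (suc (length xs)) m ((a ≡ᵇ 0) ∨ hasZero xs) (((a + a) ≡ᵇ q) ∨ hasHalf xs) else + 0)
      extend a a<q with admissible xs a in a-ok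
      ... | true  = count-extensions m (a ∷ xs) (a<q , a-ok , xs✓)
      ... | false = refl

    charQP≡ways : ∀ m → + charQP (D m t s) q ≡ ways 0 m false false
    charQP≡ways m =
      trans (cong (λ l → + length l) (Listₚ.filter-≐ _ (λ v → T? (extendsᵇ [] m v)) (to , from) (allVecs m q)))
            (count-extensions m [] tt)
      where
      to : ∀ {x} → All (NonzeroEntry x) (D m t s) → T (extendsᵇ [] m x)
      to {x} nonzero = ≡true⇒T (Extends⇒extendsᵇ [] m x (D⇒Extends m x nonzero))
      from : ∀ {x} → T (extendsᵇ [] m x) → All (NonzeroEntry x) (D m t s)
      from {x} ok = Extends⇒D m x (extendsᵇ⇒Extends [] m x (T⇒≡true ok))

module Divisibility where

  open import Data.Nat as ℕ using (_+_; _*_; _/_; NonZero)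
  import Data.Nat.Properties as ℕₚ
  open import Data.Nat.Divisibility
  open import Data.Nat.GCD using (gcd; gcd[m,n]∣m; gcd[m,n]∣n; gcd[m,n]≢0; gcd-greatest)
  open import Data.Nat.Coprimality using (coprime-/gcd; coprime-divisor)
  open import Data.Nat.DivMod using (m/n*n≡m)
  open import Data.Bool using (true)
  open import Data.Empty using (⊥-elim)
  open import Data.Sum using (inj₁)
  open import Relation.Nullary using (yes; no; does)
  open import Relation.Nullary.Decidable using (dec-true)
  open import Relation.Binary.PropositionalEquality
  open ≡-Reasoning
  open Count

  count-multiples : ∀ k n → 0 < n → count (k * n) (λ a → does (n ∣? a)) ≡ k
  count-multiples zero    n n>0 = refl
  count-multiples (suc k) n n>0 = begin
    count (n + k * n) multiple             ≡⟨ cong (λ l → count l multiple) (ℕₚ.+-comm n (k * n)) ⟩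
    count (k * n + n) multiple             ≡⟨ count-+ (k * n) n multiple ⟩
    count (k * n) multiple + count n (λ a → multiple (k * n + a))
                                           ≡⟨ cong₂ _+_ (count-multiples k n n>0) only-first ⟩
    k + 1                                  ≡⟨ ℕₚ.+-comm k 1 ⟩
    suc k                                  ∎
    where
    multiple : ℕ → Bool
    multiple a = does (n ∣? a)
    n∣kn = n∣m*n k {n}
    only-first : count n (λ a → multiple (k * n + a)) ≡ 1
    only-first = trans (count-atMostOne n _ 0 n>0 only-0)
                       (cong 𝟙 (dec-true (n ∣? (k * n + 0)) (subst (n ∣_) (sym (ℕₚ.+-identityʳ _)) n∣kn)))
      where
      only-0 : ∀ a → a < n → multiple (k * n + a) ≡ true → a ≡ 0
      only-0 a a<n _ with n ∣? (k * n + a)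
      only-0 zero    _   _  | yes _     = refl
      only-0 (suc a) a<n _  | yes n∣kn+a = ⊥-elim (ℕₚ.<-irrefl refl (ℕₚ.<-≤-trans a<n (∣⇒≤ (∣m+n∣m⇒∣n n∣kn+a n∣kn))))
      only-0 a       _   () | no _

  -- Writing g = gcd q c, q ∣ c a exactly when q / g ∣ a, and among 0, …, q - 1 there are g such a.
  count-annihilated : ∀ q c → 0 < q → count q (λ a → does (q ∣? c * a)) ≡ gcd q c
  count-annihilated q c q>0 =
    trans (count-cong q (λ a _ → reduce a))
          (trans (cong (λ l → count l (λ a → does (q′ ∣? a))) q≡gq′) (count-multiples g q′ q′>0))
    where
    g = gcd q c
    instance
      g≢0 : NonZero g
      g≢0 = ℕ.≢-nonZero (gcd[m,n]≢0 q c (inj₁ (λ q≡0 → ℕₚ.<-irrefl (sym q≡0) q>0)))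
    q′ = q / g
    c′ = c / g
    q′g≡q : q′ * g ≡ q
    q′g≡q = m/n*n≡m (gcd[m,n]∣m q c)
    c′g≡c : c′ * g ≡ c
    c′g≡c = m/n*n≡m (gcd[m,n]∣n q c)
    q≡gq′ : q ≡ g * q′
    q≡gq′ = trans (sym q′g≡q) (ℕₚ.*-comm q′ g)
    q′>0 : 0 < q′
    q′>0 = ℕₚ.n≢0⇒n>0 (λ q′≡0 → ℕₚ.<-irrefl (sym (trans (sym q′g≡q) (cong (_* g) q′≡0))) q>0)
    reduce : ∀ a → does (q ∣? c * a) ≡ does (q′ ∣? a)
    reduce a = Booleans.does-⇔ (q ∣? c * a) (q′ ∣? a) to from
      where
      ca≡c′ag : c * a ≡ c′ * a * g
      ca≡c′ag = trans (cong (_* a) (sym c′g≡c))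
                  (trans (ℕₚ.*-assoc c′ g a) (trans (cong (c′ *_) (ℕₚ.*-comm g a)) (sym (ℕₚ.*-assoc c′ a g))))
      to : q ∣ c * a → q′ ∣ a
      to q∣ca = coprime-divisor (coprime-/gcd q c) (*-cancelʳ-∣ g (subst₂ _∣_ (sym q′g≡q) ca≡c′ag q∣ca))
      from : q′ ∣ a → q ∣ c * a
      from q′∣a = subst₂ _∣_ q′g≡q (sym (trans ca≡c′ag (ℕₚ.*-assoc c′ a g))) (∣-trans (*-monoˡ-∣ g q′∣a) (n∣m*n c′))

  gcd-+-multiple : ∀ k ρ n c → c ∣ ρ → gcd (k + ρ * n) c ≡ gcd k c
  gcd-+-multiple k ρ n c c∣ρ = ∣-antisym
    (gcd-greatest (∣m+n∣m⇒∣n (subst (gcd (k + ρ * n) c ∣_) (ℕₚ.+-comm k (ρ * n)) (gcd[m,n]∣m (k + ρ * n) c))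
                             (∣-trans (gcd[m,n]∣n (k + ρ * n) c) c∣ρn))
                  (gcd[m,n]∣n (k + ρ * n) c))
    (gcd-greatest (∣m∣n⇒∣m+n (gcd[m,n]∣m k c) (∣-trans (gcd[m,n]∣n k c) c∣ρn)) (gcd[m,n]∣n k c))
    where
    c∣ρn : c ∣ ρ * n
    c∣ρn = ∣m⇒∣m*n n c∣ρ

module Period where

  open import Data.Nat using (s≤s; z≤n)
  import Data.Nat.Properties as ℕₚ
  open import Data.Nat.Divisibility using (∣-refl; ∣-trans)
  open import Data.Nat.LCM using (m∣lcm[m,n]; n∣lcm[m,n])
  open import Data.Sum using (inj₁; inj₂)
  open import Relation.Binary.PropositionalEquality using (refl)

  2∣rho : ∀ t s → 2 ∣ rho t s
  2∣rho zero    s = ∣-refl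
  2∣rho (suc t) s = n∣lcm[m,n] (s 1) 2

  divisibility-chain : ∀ t (s : ℕ → ℕ) → (∀ i → 1 ≤ i → i < t → s (suc i) ∣ s i) →
    ∀ j p → j ≤ p → p < t → s (suc p) ∣ s (suc j)
  divisibility-chain t s s-divides zero    zero    _   _   = ∣-refl
  divisibility-chain t s s-divides j       (suc p) j≤p p<t with ℕₚ.m≤n⇒m<n∨m≡n j≤p
  ... | inj₂ refl = ∣-refl
  ... | inj₁ j<p  = ∣-trans (s-divides (suc p) (s≤s z≤n) p<t)
                            (divisibility-chain t s s-divides j p (ℕₚ.≤-pred j<p) (ℕₚ.<-trans (ℕₚ.n<1+n p) p<t))

  s∣rho : ∀ t s → (∀ p → p < t → s (suc p) ∣ s 1) → ∀ p → p < t → s (suc p) ∣ rho t s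
  s∣rho (suc t) s s∣s₁ p p<t = ∣-trans (s∣s₁ p p<t) (m∣lcm[m,n] (s 1) 2)

module Constituents (m r t : ℕ) (s : ℕ → ℕ) (r≤t : r ≤ t) (t≤m : t ≤ m)
                    (even-s : ∀ i → 1 ≤ i → i ≤ r → 2 ∣ s i)
                    (odd-s : ∀ i → r < i → i ≤ t → ¬ (2 ∣ s i))
                    (s-divides : ∀ i → 1 ≤ i → i < t → s (suc i) ∣ s i)
                    (k : ℕ) (1≤k : 1 ≤ k) (n : ℕ) where

  open import Data.Nat as ℕ using (z≤n)
  import Data.Nat.Properties as ℕₚ
  open import Data.Nat.Divisibility
    using (_∣?_; divides; ∣m+n∣m⇒∣n; ∣m∣n⇒∣m+n; ∣m⇒∣m*n; m∣m*n; *-cancelʳ-∣; *-monoˡ-∣)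
  open import Data.Nat.GCD using (gcd)
  open import Data.Integer using (ℤ; +_; _+_; _*_)
  open import Data.Bool using (true; false; not)
  open import Relation.Nullary using (does)
  open import Relation.Nullary.Decidable using (dec-true; dec-false)
  open import Relation.Binary.PropositionalEquality
  open Period

  q : ℕ
  q = k ℕ.+ rho t s ℕ.* n

  q>0 : 0 < q
  q>0 = ℕₚ.≤-trans 1≤k (ℕₚ.m≤m+n k _)

  s-chain : ∀ j p → j ≤ p → p < t → s (suc p) ∣ s (suc j)
  s-chain = divisibility-chain t s s-divides

  d : ℕ → ℕ
  d i = gcd k (s i)

  sEven : ℕ → Bool
  sEven i = does (2 ∣? s i)

  open Residues q q>0 t s s-chain using (Parity; even; odd; annihilates)

  count-annihilates : ∀ p → p < t → Count.count q (annihilates p) ≡ d (suc p)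
  count-annihilates p p<t =
    trans (Divisibility.count-annihilated q (s (suc p)) q>0)
          (Divisibility.gcd-+-multiple k (rho t s) n (s (suc p)) (s∣rho t s (λ p p<t → s-chain 0 p z≤n p<t) p p<t))

  annihilates-half : ∀ h p → q ≡ h ℕ.+ h → p < t → annihilates p h ≡ sEven (suc p)
  annihilates-half h p q≡2h _ = Booleans.does-⇔ (q ∣? _) (2 ∣? s (suc p)) to from
    where
    q≡2*h : q ≡ 2 ℕ.* h
    q≡2*h = trans q≡2h (cong (λ w → h ℕ.+ w) (sym (ℕₚ.+-identityʳ h)))
    h>0 : 0 < h
    h>0 = ℕₚ.n≢0⇒n>0 (λ h≡0 → ℕₚ.<-irrefl (sym (trans q≡2*h (cong (2 ℕ.*_) h≡0))) q>0)
    to : q ∣ s (suc p) ℕ.* h → 2 ∣ s (suc p)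
    to q∣ = *-cancelʳ-∣ h {{ℕ.>-nonZero h>0}} (subst (_∣ s (suc p) ℕ.* h) q≡2*h q∣)
    from : 2 ∣ s (suc p) → q ∣ s (suc p) ℕ.* h
    from 2∣s = subst (_∣ s (suc p) ℕ.* h) (sym q≡2*h) (*-monoˡ-∣ h 2∣s)

  2∣ρn : 2 ∣ rho t s ℕ.* n
  2∣ρn = ∣m⇒∣m*n n (2∣rho t s)

  parity-odd : ¬ (2 ∣ k) → Parity false
  parity-odd k-odd = odd (λ a 2a≡q → k-odd (∣m+n∣m⇒∣n (subst (2 ∣_) (trans 2a≡q (ℕₚ.+-comm k _)) (two∣a+a a)) 2∣ρn))
    where
    two∣a+a : ∀ a → 2 ∣ a ℕ.+ a
    two∣a+a a = subst (2 ∣_) (cong (λ w → a ℕ.+ w) (ℕₚ.+-identityʳ a)) (m∣m*n {2} a)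

  parity-even : 2 ∣ k → Parity true
  parity-even 2∣k with ∣m∣n⇒∣m+n 2∣k 2∣ρn
  ... | divides h q≡h*2 = even h (trans q≡h*2 (trans (ℕₚ.*-comm h 2) (cong (λ w → h ℕ.+ w) (ℕₚ.+-identityʳ h))))

  open Reduction q q>0 t s s-chain using (module Counting)
  open Factors q t d public

  odd-constituent : ¬ (2 ∣ k) → + charQP (D m t s) q
    ≡ prodR 1 t (headFactor (+ 2)) * (prodR (suc t) m (tailFactor (+ 1)) + + (m ∸ t) * prodR (suc t) (m ∸ 1) (tailFactor (+ 1)))
  odd-constituent k-odd =
    trans (Counting.charQP≡ways false (parity-odd k-odd) sEven d count-annihilates annihilates-half m)
          (OddWays.ways-closedForm q t sEven d t≤m)

  even-constituent : 2 ∣ k → + charQP (D m t s) q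
    ≡ prodR 1 r (headFactor (+ 2))
      * (prodR (suc r) t (headFactor (+ 1))
           * (prodR (suc t) m baseFactor + + 2 * + (m ∸ t) * prodR (suc t) (m ∸ 1) baseFactor
              + + (m ∸ t) * + (m ∸ t ∸ 1) * prodR (suc t) (m ∸ 2) baseFactor)
         + halfPlacements r * (prodR (suc t) m (tailFactor (+ 2)) + + (m ∸ t) * prodR (suc t) (m ∸ 1) (tailFactor (+ 2))))
  even-constituent 2∣k =
    trans (Counting.charQP≡ways true (parity-even 2∣k) sEven d count-annihilates annihilates-half m)
          (EvenWays.ways-closedForm q t sEven d r≤t t≤m halfForbidden halfAllowed)
    where
    halfForbidden : ∀ i → i < r → not (sEven (suc i)) ≡ false
    halfForbidden i i<r = cong not (dec-true (2 ∣? s (suc i)) (even-s (suc i) (ℕ.s≤s z≤n) i<r))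
    halfAllowed : ∀ i → r ≤ i → i < t → not (sEven (suc i)) ≡ true
    halfAllowed i r≤i i<t = cong not (dec-false (2 ∣? s (suc i)) (odd-s (suc i) (ℕ.s≤s r≤i) i<t))

open import Data.Integer using (ℤ; +_; _+_; _-_; _*_)
open import Data.Product using (_×_; _,_)
open ClosedForms using (*-emptyTail₁; *-emptyTail₂)

theorem3p5 :
    (m r t : ℕ) (s : ℕ → ℕ) → 1 ≤ m → r ≤ t → t ≤ m →
    (∀ i → 1 ≤ i → i ≤ t → 0 < s i) →
    (∀ i → 1 ≤ i → i ≤ r → 2 ∣ s i) →
    (∀ i → r < i → i ≤ t → ¬ (2 ∣ s i)) →
    (∀ i → 1 ≤ i → i < t → s (suc i) ∣ s i) →
    (k : ℕ) → 1 ≤ k → k ∣ rho t s →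
    let d : ℕ → ℤ
        d i = + gcd k (s i)
    in
    ((¬ (2 ∣ k)) → (n : ℕ) →
      let q = + (k Data.Nat.+ rho t s Data.Nat.* n) in
      + charQP (D m t s) (k Data.Nat.+ rho t s Data.Nat.* n)
        ≡ prodR 1 t (λ i → q - d i - + (2 Data.Nat.* i) + + 2)
          * (prodR (suc t) m (λ i → q - + (2 Data.Nat.* i) + + 1)
             + + (m ∸ t) * prodR (suc t) (m ∸ 1) (λ i → q - + (2 Data.Nat.* i) + + 1)))
    ×
    ((2 ∣ k) → (n : ℕ) →
      let q = + (k Data.Nat.+ rho t s Data.Nat.* n)
          P₁ = prodR (suc r) t (λ i → q - d i - + (2 Data.Nat.* i) + + 1)
               * (prodR (suc t) m (λ i → q - + (2 Data.Nat.* i))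
                  + + 2 * + (m ∸ t) * prodR (suc t) (m ∸ 1) (λ i → q - + (2 Data.Nat.* i))
                  + + (m ∸ t) * + (m ∸ t ∸ 1) * prodR (suc t) (m ∸ 2) (λ i → q - + (2 Data.Nat.* i)))
          P₂ = sumR (suc r) t (λ i → prodR (suc r) (i ∸ 1) (λ j → q - d j - + (2 Data.Nat.* j) + + 1)
                                     * prodR (suc i) t (λ j → q - d j - + (2 Data.Nat.* j) + + 3))
               * (prodR (suc t) m (λ i → q - + (2 Data.Nat.* i) + + 2)
                  + + (m ∸ t) * prodR (suc t) (m ∸ 1) (λ i → q - + (2 Data.Nat.* i) + + 2))
      in
      + charQP (D m t s) (k Data.Nat.+ rho t s Data.Nat.* n)
        ≡ prodR 1 r (λ i → q - d i - + (2 Data.Nat.* i) + + 2) * (P₁ + P₂))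
    ×
    (t ≡ m →
      ((¬ (2 ∣ k)) → (n : ℕ) →
        let q = + (k Data.Nat.+ rho t s Data.Nat.* n) in
        + charQP (D m t s) (k Data.Nat.+ rho t s Data.Nat.* n)
          ≡ prodR 1 m (λ i → q - d i - + (2 Data.Nat.* i) + + 2))
      ×
      ((2 ∣ k) → (n : ℕ) →
        let q = + (k Data.Nat.+ rho t s Data.Nat.* n) in
        + charQP (D m t s) (k Data.Nat.+ rho t s Data.Nat.* n)
          ≡ prodR 1 r (λ i → q - d i - + (2 Data.Nat.* i) + + 2)
            * (prodR (suc r) m (λ i → q - d i - + (2 Data.Nat.* i) + + 1)
               + sumR (suc r) m (λ i → prodR (suc r) (i ∸ 1) (λ j → q - d j - + (2 Data.Nat.* j) + + 1)
                                        * prodR (suc i) m (λ j → q - d j - + (2 Data.Nat.* j) + + 3)))))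
theorem3p5 m r t s _ r≤t t≤m _ even-s odd-s s-divides k 1≤k _ =
  (λ k-odd n → C.odd-constituent n k-odd) ,
  (λ k-even n → C.even-constituent n k-even) ,
  λ { refl → (λ k-odd n → trans (C.odd-constituent n k-odd) (*-emptyTail₁ t _ (C.tailFactor n (+ 1)))) ,
             (λ k-even n → trans (C.even-constituent n k-even)
                                 (*-emptyTail₂ t (prodR 1 r (C.headFactor n (+ 2))) (prodR (suc r) t (C.headFactor n (+ 1)))
                                               (C.halfPlacements n r) (C.baseFactor n) (C.tailFactor n (+ 2)))) }
  where
  module C n = Constituents m r t s r≤t t≤m even-s odd-s s-divides k 1≤k n
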